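{- Let $\{\alpha_0,\alpha_1,\dots,\alpha_{k-1}\}\subset\mathbb{F}_{2^m}$ be a set of $k$ elements linearly independent over $\mathbb{F}_2$. For $i=0,\dots,k-1$ let $f_i(x,y)=\mathrm{Tr}^m_1(x\pi_i(y))$ for $x,y\in\mathbb{F}_{2^m}$, where $\pi_i(y)=\alpha_iy^{ -1}$ for $y\in\mathbb{F}_{2^m}^*$ and $\pi_i(0)=0$. Then the function $F:\mathbb{F}_{2^m}\times\mathbb{F}_{2^m}\to\mathbb{Z}_{2^k}$, $F(x,y)=f_0(x,y)+2f_1(x,y)+\cdots+2^{k-1}f_{k-1}(x,y)$, is $\mathbb{Z}_{2^k}$-bent.
   Context: $\mathrm{Tr}^m_1$ is the absolute trace $\mathbb{F}_{2^m}\to\mathbb{F}_2$; the values $f_i\in\{0,1\}$ are regarded as integers. A function $F:\mathbb{F}_{2^m}\times\mathbb{F}_{2^m}\to\mathbb{Z}_{2^k}$ is $\mathbb{Z}_{2^k}$-bent if $\bigl|\sum_{x,y\in\mathbb{F}_{2^m}}\zeta_{2^k}^{cF(x,y)}(-1)^{\mathrm{Tr}^m_1(u_1x+u_2y)}\bigr|=2^m$ for all $(u_1,u_2)\in\mathbb{F}_{2^m}^2$ and all nonzero $c\in\mathbb{Z}_{2^k}$, where $\zeta_{2^k}=e^{2\pi\sqrt{ -1}/2^k}$. -}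

module Defs where

open import Level using (0ℓ)
open import Data.Nat as ℕ using (ℕ; zero; suc; _^_; _<_)
open import Data.Nat.Properties using (m^n≢0)
open import Data.Nat.DivMod using (_%_; _/_)
open import Data.Integer as ℤ using (ℤ; +_)
open import Data.Fin as Fin using (Fin; toℕ)
open import Data.Bool using (Bool; true; false; if_then_else_)
open import Data.List using (List; []; _∷_; length; foldr; map; allFin; upTo; concatMap)
open import Data.List.Membership.Propositional using (_∈_)
open import Data.List.Relation.Unary.Unique.Propositional using (Unique)
open import Relation.Nullary using (yes; no; ¬_)
open import Relation.Binary.PropositionalEquality using (_≡_; _≢_)
open import Relation.Binary.Definitions using (DecidableEquality)
open import Data.Product using (_×_; _,_)
open import Algebra.Structures using (IsCommutativeRing)

record GF2^ (m : ℕ) : Set₁ where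
  infixl 6 _+_
  infixl 7 _*_
  field
    Carrier : Set
    _+_ _*_ : Carrier → Carrier → Carrier
    -_      : Carrier → Carrier
    0# 1#   : Carrier
    isCommutativeRing : IsCommutativeRing _≡_ _+_ _*_ -_ 0# 1#
    _⁻¹     : Carrier → Carrier
    inverseʳ : ∀ x → x ≢ 0# → x * (x ⁻¹) ≡ 1#
    0≢1     : 0# ≢ 1#
    _≟_     : DecidableEquality Carrier
    elements : List Carrier
    complete : ∀ x → x ∈ elements
    unique   : Unique elements
    size     : length elements ≡ 2 ^ m
    char2    : 1# + 1# ≡ 0#

module FieldOps {m : ℕ} (𝔽 : GF2^ m) where
  open GF2^ 𝔽

  pow : Carrier → ℕ → Carrier
  pow x zero    = 1#
  pow x (suc n) = x * pow x n

  sumF : List Carrier → Carrier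
  sumF = foldr _+_ 0#

  Tr : Carrier → Carrier
  Tr x = sumF (map (λ i → pow x (2 ^ i)) (upTo m))

  -- the value of an element of F_2 = {0,1} ⊆ F_{2^m} regarded as an integer
  toBit : Carrier → ℕ
  toBit z with z ≟ 0#
  ... | yes _ = 0
  ... | no  _ = 1

  πα : Carrier → Carrier → Carrier
  πα α y with y ≟ 0#
  ... | yes _ = 0#
  ... | no  _ = α * (y ⁻¹)

  LinIndepF2 : (k : ℕ) → (Fin k → Carrier) → Set
  LinIndepF2 k α = (s : Fin k → Bool) →
    sumF (map (λ i → if s i then α i else 0#) (allFin k)) ≡ 0# →
    ∀ i → s i ≡ false

-- The cyclotomic ring ℤ[ζ_{2^(k+1)}] ≅ ℤ[X]/(X^(2^k) + 1), embedded in ℂ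
-- via X ↦ ζ_{2^(k+1)} = e^{2πi/2^(k+1)}.  Elements are coefficient
-- vectors Fin (2^k) → ℤ.  ζ_{2^k} = X², and -1 ∈ ℤ.

record Cyc (k : ℕ) : Set where
  constructor cyc
  field coeff : Fin (2 ^ k) → ℤ
open Cyc public

sumℤ : List ℤ → ℤ
sumℤ = foldr ℤ._+_ (+ 0)

-- coefficient of X^j in the (reduced) monomial X^e, using X^(2^k) = -1
monoCoeff : (k e : ℕ) → Fin (2 ^ k) → ℤ
monoCoeff k e j with toℕ j ℕ.≟ (e % (2 ^ k)) {{m^n≢0 2 k}}
... | no _  = + 0
... | yes _ with (e / (2 ^ k)) {{m^n≢0 2 k}} % 2
...   | zero = + 1
...   | _    = ℤ.- (+ 1)

mono : (k e : ℕ) → Cyc k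
mono k e = cyc (monoCoeff k e)

_⊕_ : ∀ {k} → Cyc k → Cyc k → Cyc k
a ⊕ b = cyc (λ j → coeff a j ℤ.+ coeff b j)

scale : ∀ {k} → ℤ → Cyc k → Cyc k
scale z a = cyc (λ j → z ℤ.* coeff a j)

zeroC : ∀ {k} → Cyc k
zeroC = cyc (λ _ → + 0)

sumC : ∀ {k} → List (Cyc k) → Cyc k
sumC = foldr _⊕_ zeroC

_⊗_ : ∀ {k} → Cyc k → Cyc k → Cyc k
_⊗_ {k} a b = sumC (concatMap (λ i → map (λ j →
  scale (coeff a i ℤ.* coeff b j) (mono k (toℕ i ℕ.+ toℕ j))) (allFin (2 ^ k))) (allFin (2 ^ k)))

-- complex conjugation: X^i ↦ X^(-i) = X^(2·2^k - i)
conj : ∀ {k} → Cyc k → Cyc k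
conj {k} a = sumC (map (λ i → scale (coeff a i) (mono k (2 ℕ.* 2 ^ k ℕ.∸ toℕ i))) (allFin (2 ^ k)))

constC : ∀ {k} → ℤ → Cyc k
constC {k} n = cyc {k} (λ j → if toℕ j ℕ.≡ᵇ 0 then n else + 0)

-- |z| = r (r ≥ 0) is equivalent to z · conj z = r², stated coefficientwise
AbsEq : ∀ {k} → Cyc k → ℕ → Set
AbsEq {k} z r = ∀ j → coeff (z ⊗ conj z) j ≡ coeff (constC {k} (+ (r ℕ.* r))) j

-- Z_{2^k}-bentness of F : F_{2^m} × F_{2^m} → Z_{2^k}
-- (F given by a natural-number representative; ζ_{2^k}^{cF} = X^{2cF}).

module Bent {m : ℕ} (𝔽 : GF2^ m) where
  open GF2^ 𝔽
  open FieldOps 𝔽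

  pairs : List (Carrier × Carrier)
  pairs = concatMap (λ x → map (λ y → x , y) elements) elements

  walsh : (k : ℕ) → (Carrier → Carrier → ℕ) → ℕ → Carrier → Carrier → Cyc k
  walsh k F c u₁ u₂ = sumC (map term pairs)
    where
    term : Carrier × Carrier → Cyc k
    term (x , y) = scale (sign (toBit (Tr (u₁ * x + u₂ * y))))
                         (mono k (2 ℕ.* (c ℕ.* F x y)))
      where
      sign : ℕ → ℤ
      sign zero = + 1
      sign _    = ℤ.- (+ 1)

  IsZ2^kBent : (k : ℕ) → (Carrier → Carrier → ℕ) → Set
  IsZ2^kBent k F = ∀ (u₁ u₂ : Carrier) (c : ℕ) → 0 < c → c < 2 ^ k →
    AbsEq (walsh k F c u₁ u₂) (2 ^ m)

  fᵢ : Carrier → Carrier → Carrier → ℕ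
  fᵢ α x y = toBit (Tr (x * πα α y))

  Fα : (k : ℕ) → (Fin k → Carrier) → Carrier → Carrier → ℕ
  Fα k α x y = foldr ℕ._+_ 0 (map (λ i → 2 ^ toℕ i ℕ.* fᵢ (α i) x y) (allFin k))

module Submission where

-- Write G z = Σᵢ 2 ^ i Tr (αᵢ z), so that F (z y , y) = G z for y ≢ 0 and F (x , 0) = 0, and let
-- C γ = Σ_y (-1) ^ Tr (γ y), which is 2 ^ m for γ = 0 and 0 otherwise because Tr is nondegenerate
-- (a polynomial of degree 2 ^ (m - 1) cannot vanish on all of the field).
-- Substituting x = z y in every column y ≢ 0 of the Walsh sum gives
--   W (u₁ , u₂) = Σ_z C (u₁ z + u₂) ζ ^ (c G z) + C u₁,
-- provided Σ_z ζ ^ (c G z) = 0. That holds because for c = 2 ^ j · odd and l = k - 1 - j,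
-- translating z by an element w with Tr (αᵢ w) = δᵢₗ (it exists since the αᵢ are linearly
-- independent) changes c G z by an odd multiple of 2 ^ (k - 1), i.e. negates ζ ^ (c G z).
-- Hence W (u₁ , u₂) is 2 ^ m for u₁ = 0 and 2 ^ m ζ ^ (c G (u₂ / u₁)) otherwise; either way |W| = 2 ^ m.

open import Level using (0ℓ)
open import Algebra.Core using (Op₂)
open import Algebra.Structures using (IsCommutativeMonoid; IsCommutativeRing)
open import Algebra.Bundles using (CommutativeRing)
open import Tactic.RingSolver.Core.AlmostCommutativeRing using (AlmostCommutativeRing; fromCommutativeRing)
open import Data.Maybe using (nothing)
open import Data.Bool using (Bool; true; false; if_then_else_)
open import Data.Sum using (_⊎_; inj₁; inj₂)
open import Relation.Nullary using (Dec; yes; no; ¬?; does; contradiction)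
open import Relation.Nullary.Decidable using (dec-true; dec-false; decidable-stable)
open import Relation.Binary.Definitions using (tri<; tri≈; tri>)
open import Data.Product using (Σ; _,_; ∃; _×_; proj₁; proj₂)
open import Defs using (GF2^; module FieldOps; module Bent; Cyc; coeff; monoCoeff; mono; scale; sumC; _⊗_; conj; constC; AbsEq)
open import Data.Fin as Fin using (Fin; zero; suc; toℕ; fromℕ<)
import Data.Vec.Functional as Vector
open import Data.Fin.Properties using (toℕ-fromℕ<; toℕ-injective)
open import Data.List using (List; []; _∷_; [_]; _∷ʳ_; map; foldr; concatMap; _++_; allFin; upTo; length; tabulate)
open import Data.List.Properties using (map-tabulate; map-upTo; upTo-∷ʳ; length-tabulate)
open import Data.List.Membership.Propositional using (_∈_)
open import Data.List.Membership.Propositional.Properties using (∈-map⁺; ∈-allFin; ∈-upTo⁺; ∈-upTo⁻)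
open import Data.List.Membership.Propositional.Properties.WithK using (unique∧set⇒bag)
open import Data.List.Relation.Unary.Any as Any using (here; there; any?; satisfied)
open import Data.List.Relation.Unary.All as All using (All; []; _∷_)
open import Data.List.Relation.Unary.All.Properties using (tabulate⁻)
open import Data.List.Relation.Unary.AllPairs using (_∷_)
open import Data.List.Relation.Unary.Unique.Propositional using (Unique)
import Data.List.Relation.Unary.Unique.Propositional.Properties as Unique
open import Data.List.Relation.Unary.Unique.Propositional.Properties using (allFin⁺; upTo⁺)
open import Data.List.Relation.Binary.BagAndSetEquality using (∼bag⇒↭)
open import Data.List.Relation.Binary.Permutation.Propositional using (_↭_; ↭⇒↭ₛ)
import Data.List.Relation.Binary.Permutation.Propositional.Properties as ↭
import Data.List.Relation.Binary.Permutation.Setoid.Properties as Permutation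
open import Data.Nat as ℕ using (ℕ; zero; suc; _^_; _≤_; _<_)
open import Data.Nat.DivMod using (_%_; _/_; m%n<n; m≡m%n+[m/n]*n; [m+kn]%n≡m%n; +-distrib-/-∣ʳ; m*n/n≡m; 0/n≡0; m<n⇒m%n≡m)
open import Data.Nat.Divisibility using (n∣m*n)
open import Data.Integer as ℤ using (ℤ; 0ℤ; 1ℤ; -1ℤ)
import Data.Integer.Properties as ℤ
open import Algebra.Properties.CommutativeSemigroup ℤ.*-commutativeSemigroup using (x∙yz≈y∙xz; xy∙z≈xz∙y; xy∙z≈x∙zy)
open import Data.Integer.Tactic.RingSolver using () renaming (solve-∀ to ℤ-solve)
open import Data.Nat.Tactic.RingSolver using () renaming (solve-∀ to ℕ-solve)
import Data.Nat.Properties as ℕ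
import Algebra.Properties.CommutativeSemigroup ℕ.*-commutativeSemigroup as ℕ*
open import Function using (_∘_; mk⇔)
open import Relation.Binary.PropositionalEquality hiding ([_])

module BigOperators {A : Set} {_∙_ : Op₂ A} {ε : A}
                    (isCommutativeMonoid : IsCommutativeMonoid _≡_ _∙_ ε) where

  open IsCommutativeMonoid isCommutativeMonoid using (assoc; comm; identityˡ; identityʳ)
  open ≡-Reasoning

  ∑ : {I : Set} → List I → (I → A) → A
  ∑ xs f = foldr _∙_ ε (map f xs)

  module _ {I : Set} where

    ∑-cong-∈ : {f g : I → A} (xs : List I) → (∀ {x} → x ∈ xs → f x ≡ g x) → ∑ xs f ≡ ∑ xs g
    ∑-cong-∈ []       eq = refl
    ∑-cong-∈ (x ∷ xs) eq = cong₂ _∙_ (eq (here refl)) (∑-cong-∈ xs (eq ∘ there))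

    ∑-cong : {f g : I → A} (xs : List I) → (∀ x → f x ≡ g x) → ∑ xs f ≡ ∑ xs g
    ∑-cong xs eq = ∑-cong-∈ xs (λ {x} _ → eq x)

    ∑-ε : (xs : List I) → ∑ xs (λ _ → ε) ≡ ε
    ∑-ε []       = refl
    ∑-ε (x ∷ xs) = trans (cong (ε ∙_) (∑-ε xs)) (identityˡ ε)

    ∑-++ : (xs ys : List I) (f : I → A) → ∑ (xs ++ ys) f ≡ ∑ xs f ∙ ∑ ys f
    ∑-++ []       ys f = sym (identityˡ _)
    ∑-++ (x ∷ xs) ys f = trans (cong (f x ∙_) (∑-++ xs ys f)) (sym (assoc _ _ _))

    ∑-distrib : (xs : List I) (f g : I → A) → ∑ xs (λ x → f x ∙ g x) ≡ ∑ xs f ∙ ∑ xs g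
    ∑-distrib []       f g = sym (identityˡ ε)
    ∑-distrib (x ∷ xs) f g = begin
      (f x ∙ g x) ∙ ∑ xs (λ x → f x ∙ g x) ≡⟨ cong (_ ∙_) (∑-distrib xs f g) ⟩
      (f x ∙ g x) ∙ (∑ xs f ∙ ∑ xs g)      ≡⟨ assoc _ _ _ ⟩
      f x ∙ (g x ∙ (∑ xs f ∙ ∑ xs g))      ≡⟨ cong (f x ∙_) (sym (assoc _ _ _)) ⟩
      f x ∙ ((g x ∙ ∑ xs f) ∙ ∑ xs g)      ≡⟨ cong (λ t → f x ∙ (t ∙ ∑ xs g)) (comm _ _) ⟩
      f x ∙ ((∑ xs f ∙ g x) ∙ ∑ xs g)      ≡⟨ cong (f x ∙_) (assoc _ _ _) ⟩
      f x ∙ (∑ xs f ∙ (g x ∙ ∑ xs g))      ≡⟨ sym (assoc _ _ _) ⟩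
      (f x ∙ ∑ xs f) ∙ (g x ∙ ∑ xs g)      ∎

    ∑-single : (xs : List I) (f : I → A) {c : I} → Unique xs → c ∈ xs →
               (∀ {x} → x ∈ xs → x ≢ c → f x ≡ ε) → ∑ xs f ≡ f c
    ∑-single (x ∷ xs) f (x∉xs ∷ _) (here refl) off = begin
      f x ∙ ∑ xs f        ≡⟨ cong (f x ∙_) (∑-cong-∈ xs (λ y∈xs → off (there y∈xs) (All.lookup x∉xs y∈xs ∘ sym))) ⟩
      f x ∙ ∑ xs (λ _ → ε) ≡⟨ cong (f x ∙_) (∑-ε xs) ⟩
      f x ∙ ε             ≡⟨ identityʳ (f x) ⟩
      f x                 ∎
    ∑-single (x ∷ xs) f (x∉xs ∷ u) (there c∈xs) off = begin
      f x ∙ ∑ xs f ≡⟨ cong₂ _∙_ (off (here refl) (λ { refl → All.lookup x∉xs c∈xs refl }))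
                                (∑-single xs f u c∈xs (off ∘ there)) ⟩
      ε ∙ f _      ≡⟨ identityˡ _ ⟩
      f _          ∎

  ∑-hom : {I : Set} (h : A → A) → h ε ≡ ε → (∀ a b → h (a ∙ b) ≡ h a ∙ h b) →
          (xs : List I) (f : I → A) → h (∑ xs f) ≡ ∑ xs (h ∘ f)
  ∑-hom h h-ε h-∙ []       f = h-ε
  ∑-hom h h-ε h-∙ (x ∷ xs) f = trans (h-∙ _ _) (cong (h (f x) ∙_) (∑-hom h h-ε h-∙ xs f))

  ∑-map : {I J : Set} (g : I → J) (xs : List I) (f : J → A) → ∑ (map g xs) f ≡ ∑ xs (f ∘ g)
  ∑-map g []       f = refl
  ∑-map g (x ∷ xs) f = cong (f (g x) ∙_) (∑-map g xs f)

  ∑-concatMap : {I J : Set} (g : I → List J) (xs : List I) (f : J → A) →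
                ∑ (concatMap g xs) f ≡ ∑ xs (λ x → ∑ (g x) f)
  ∑-concatMap g []       f = refl
  ∑-concatMap g (x ∷ xs) f = trans (∑-++ (g x) (concatMap g xs) f) (cong (_ ∙_) (∑-concatMap g xs f))

  ∑-comm : {I J : Set} (xs : List I) (ys : List J) (h : I → J → A) →
           ∑ xs (λ x → ∑ ys (h x)) ≡ ∑ ys (λ y → ∑ xs (λ x → h x y))
  ∑-comm []       ys h = sym (∑-ε ys)
  ∑-comm (x ∷ xs) ys h = trans (cong (_ ∙_) (∑-comm xs ys h)) (sym (∑-distrib ys (h x) _))

  ∑-allFin-suc : (n : ℕ) (f : Fin (ℕ.suc n) → A) → ∑ (allFin (ℕ.suc n)) f ≡ f zero ∙ ∑ (allFin n) (f ∘ suc)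
  ∑-allFin-suc n f = cong (λ ys → f zero ∙ foldr _∙_ ε ys) (trans (map-tabulate suc f) (sym (map-tabulate (λ i → i) (f ∘ suc))))

  ∑-reindex : {I : Set} {xs : List I} → Unique xs → (∀ x → x ∈ xs) →
              (σ τ : I → I) → (∀ x → τ (σ x) ≡ x) → (∀ x → σ (τ x) ≡ x) →
              (f : I → A) → ∑ xs (f ∘ σ) ≡ ∑ xs f
  ∑-reindex {xs = xs} unique complete σ τ τσ στ f = begin
    ∑ xs (f ∘ σ)   ≡⟨ sym (∑-map σ xs f) ⟩
    ∑ (map σ xs) f ≡⟨ Permutation.foldr-commMonoid (setoid A) isCommutativeMonoid (↭⇒↭ₛ (↭.map⁺ f σxs↭xs)) ⟩
    ∑ xs f         ∎
    where
    σ-injective : ∀ {x y} → σ x ≡ σ y → x ≡ y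
    σ-injective {x} {y} eq = trans (sym (τσ x)) (trans (cong τ eq) (τσ y))
    σxs↭xs : map σ xs ↭ xs
    σxs↭xs = ∼bag⇒↭ (unique∧set⇒bag (Unique.map⁺ σ-injective unique) unique
      (λ {z} → mk⇔ (λ _ → complete z) (λ _ → subst (_∈ map σ xs) (στ z) (∈-map⁺ σ (complete (τ z))))))

  ∑-upTo-rotate : (n : ℕ) (g : ℕ → A) → g 0 ∙ ∑ (upTo n) (g ∘ ℕ.suc) ≡ ∑ (upTo n) g ∙ g n
  ∑-upTo-rotate n g = begin
    g 0 ∙ ∑ (upTo n) (g ∘ ℕ.suc)       ≡⟨ cong (g 0 ∙_) (sym (∑-map ℕ.suc (upTo n) g)) ⟩
    g 0 ∙ ∑ (map ℕ.suc (upTo n)) g     ≡⟨ cong (λ ys → g 0 ∙ ∑ ys g) (map-upTo ℕ.suc n) ⟩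
    ∑ (upTo (ℕ.suc n)) g               ≡⟨ cong (λ ys → ∑ ys g) (sym (upTo-∷ʳ n)) ⟩
    ∑ (upTo n ∷ʳ n) g                  ≡⟨ ∑-++ (upTo n) [ n ] g ⟩
    ∑ (upTo n) g ∙ (g n ∙ ε)           ≡⟨ cong (∑ (upTo n) g ∙_) (identityʳ (g n)) ⟩
    ∑ (upTo n) g ∙ g n                 ∎

2^-injective : ∀ {i j} → 2 ^ i ≡ 2 ^ j → i ≡ j
2^-injective {i} {j} eq with ℕ.<-cmp i j
... | tri< i<j _ _ = contradiction eq (ℕ.<⇒≢ (ℕ.^-monoʳ-< 2 (ℕ.n<1+n 1) i<j))
... | tri≈ _ i≡j _ = i≡j
... | tri> _ _ j<i = contradiction eq (ℕ.>⇒≢ (ℕ.^-monoʳ-< 2 (ℕ.n<1+n 1) j<i))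

halve : ∀ c → ∃ λ q → c ≡ 2 ℕ.* q ⊎ c ≡ suc (2 ℕ.* q)
halve zero = 0 , inj₁ refl
halve (suc c) with halve c
... | q , inj₁ c≡2q   = q , inj₂ (cong suc c≡2q)
... | q , inj₂ c≡1+2q = suc q , inj₁ (trans (cong suc c≡1+2q) (sym (ℕ.*-suc 2 q)))

odd-multiple-of-2^k : ∀ k c → 0 < c → c < 2 ^ k → ∃ λ l → l < k × ∃ λ s → 2 ℕ.* (c ℕ.* 2 ^ l) ≡ suc (2 ℕ.* s) ℕ.* 2 ^ k
odd-multiple-of-2^k zero    (suc c) _ (ℕ.s≤s ())
odd-multiple-of-2^k (suc k) c 0<c c<2^[1+k] with halve c
... | q , inj₂ refl = k , ℕ.n<1+n k , q , ℕ*.x∙yz≈y∙xz 2 (suc (2 ℕ.* q)) (2 ^ k)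
... | q , inj₁ refl with odd-multiple-of-2^k k q (positive-half q 0<c) (ℕ.*-cancelˡ-< 2 q (2 ^ k) c<2^[1+k])
  where
  positive-half : ∀ q → 0 < 2 ℕ.* q → 0 < q
  positive-half (suc q) _ = ℕ.z<s
...   | l , l<k , s , eq = l , ℕ.m<n⇒m<1+n l<k , s , (begin
  2 ℕ.* (2 ℕ.* q ℕ.* 2 ^ l)          ≡⟨ cong (2 ℕ.*_) (ℕ.*-assoc 2 q (2 ^ l)) ⟩
  2 ℕ.* (2 ℕ.* (q ℕ.* 2 ^ l))        ≡⟨ cong (2 ℕ.*_) eq ⟩
  2 ℕ.* (suc (2 ℕ.* s) ℕ.* 2 ^ k)    ≡⟨ ℕ*.x∙yz≈y∙xz 2 (suc (2 ℕ.* s)) (2 ^ k) ⟩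
  suc (2 ℕ.* s) ℕ.* 2 ^ suc k        ∎)
  where
  open ≡-Reasoning

sign : ℕ → ℤ
sign zero    = 1ℤ
sign (suc _) = -1ℤ

-1^-parity : ∀ q → -1ℤ ℤ.^ q ≡ sign (q % 2)
-1^-parity zero          = refl
-1^-parity (suc zero)    = refl
-1^-parity (suc (suc q)) = begin
  -1ℤ ℤ.* (-1ℤ ℤ.* -1ℤ ℤ.^ q) ≡⟨ ℤ.-1*i≡-i _ ⟩
  ℤ.- (-1ℤ ℤ.* -1ℤ ℤ.^ q)      ≡⟨ cong ℤ.-_ (ℤ.-1*i≡-i _) ⟩
  ℤ.- ℤ.- -1ℤ ℤ.^ q            ≡⟨ ℤ.neg-involutive _ ⟩
  -1ℤ ℤ.^ q                    ≡⟨ -1^-parity q ⟩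
  sign (q % 2)                 ∎
  where open ≡-Reasoning

-1^[2*t]≡1 : ∀ t → -1ℤ ℤ.^ (2 ℕ.* t) ≡ 1ℤ
-1^[2*t]≡1 t = trans (sym (ℤ.^-*-assoc -1ℤ 2 t)) (ℤ.^-zeroˡ t)

-1^[1+2*t]≡-1 : ∀ t → -1ℤ ℤ.^ suc (2 ℕ.* t) ≡ -1ℤ
-1^[1+2*t]≡-1 t = cong (-1ℤ ℤ.*_) (-1^[2*t]≡1 t)

module Characteristic2Field {m : ℕ} (𝔽 : GF2^ m) where

  open GF2^ 𝔽
  open FieldOps 𝔽
  open IsCommutativeRing isCommutativeRing public
    using ( +-assoc; +-comm; +-identityˡ; +-identityʳ; *-assoc; *-comm; *-identityˡ; *-identityʳ
          ; distribˡ; distribʳ; zeroˡ; zeroʳ; +-isCommutativeMonoid; *-isCommutativeMonoid)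
  open BigOperators +-isCommutativeMonoid public
  open BigOperators *-isCommutativeMonoid public
    using () renaming (∑ to ∏; ∑-cong to ∏-cong; ∑-distrib to ∏-distrib; ∑-single to ∏-single; ∑-reindex to ∏-reindex)
  open ≡-Reasoning

  commutativeRing : CommutativeRing 0ℓ 0ℓ
  commutativeRing = record { isCommutativeRing = isCommutativeRing }

  open import Algebra.Properties.CommutativeSemigroup (CommutativeRing.*-commutativeSemigroup commutativeRing) public
    using () renaming (x∙yz≈y∙xz to x*[y*z]≡y*[x*z]; interchange to [x*y]*[z*w]≡[x*z]*[y*w])

  ring : AlmostCommutativeRing 0ℓ 0ℓ
  ring = fromCommutativeRing commutativeRing (λ _ → nothing)

  open import Tactic.RingSolver.NonReflective ring public using (solve; _⊜_) renaming (_⊕_ to _:+_; _⊗_ to _:*_)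

  x+x≡0 : ∀ x → x + x ≡ 0#
  x+x≡0 x = begin
    x + x             ≡⟨ cong₂ _+_ (*-identityʳ x) (*-identityʳ x) ⟨
    x * 1# + x * 1#   ≡⟨ distribˡ x 1# 1# ⟨
    x * (1# + 1#)     ≡⟨ cong (x *_) char2 ⟩
    x * 0#            ≡⟨ zeroʳ x ⟩
    0#                ∎

  [x+y]+y≡x : ∀ x y → (x + y) + y ≡ x
  [x+y]+y≡x x y = trans (+-assoc x y y) (trans (cong (x +_) (x+x≡0 y)) (+-identityʳ x))

  x+y≡0⇒x≡y : ∀ {x y} → x + y ≡ 0# → x ≡ y
  x+y≡0⇒x≡y {x} {y} eq = trans (sym ([x+y]+y≡x x y)) (trans (cong (_+ y) eq) (+-identityˡ y))

  x⁻¹*[x*y]≡y : ∀ {x} → x ≢ 0# → ∀ y → x ⁻¹ * (x * y) ≡ y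
  x⁻¹*[x*y]≡y {x} x≢0 y = begin
    x ⁻¹ * (x * y) ≡⟨ *-assoc _ _ _ ⟨
    x ⁻¹ * x * y   ≡⟨ cong (_* y) (trans (*-comm _ _) (inverseʳ x x≢0)) ⟩
    1# * y         ≡⟨ *-identityˡ y ⟩
    y              ∎

  x*[x⁻¹*y]≡y : ∀ {x} → x ≢ 0# → ∀ y → x * (x ⁻¹ * y) ≡ y
  x*[x⁻¹*y]≡y {x} x≢0 y = trans (sym (*-assoc _ _ _)) (trans (cong (_* y) (inverseʳ x x≢0)) (*-identityˡ y))

  *-cancelˡ : ∀ {x y z} → x ≢ 0# → x * y ≡ x * z → y ≡ z
  *-cancelˡ {x} {y} {z} x≢0 eq = trans (sym (x⁻¹*[x*y]≡y x≢0 y)) (trans (cong (x ⁻¹ *_) eq) (x⁻¹*[x*y]≡y x≢0 z))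

  x*y≡0⇒y≡0 : ∀ {x y} → x ≢ 0# → x * y ≡ 0# → y ≡ 0#
  x*y≡0⇒y≡0 {x} x≢0 eq = *-cancelˡ x≢0 (trans eq (sym (zeroʳ x)))

  x*y≢0 : ∀ {x y} → x ≢ 0# → y ≢ 0# → x * y ≢ 0#
  x*y≢0 x≢0 y≢0 = y≢0 ∘ x*y≡0⇒y≡0 x≢0

  ∏≢0 : {I : Set} (xs : List I) (f : I → Carrier) → (∀ x → f x ≢ 0#) → ∏ xs f ≢ 0#
  ∏≢0 []       f f≢0 = 0≢1 ∘ sym
  ∏≢0 (x ∷ xs) f f≢0 = x*y≢0 (f≢0 x) (∏≢0 xs f f≢0)

  ∏-const : {I : Set} (xs : List I) (a : Carrier) → ∏ xs (λ _ → a) ≡ pow a (length xs)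
  ∏-const []       a = refl
  ∏-const (x ∷ xs) a = cong (a *_) (∏-const xs a)

  pow-+ : ∀ x a b → pow x (a ℕ.+ b) ≡ pow x a * pow x b
  pow-+ x zero    b = sym (*-identityˡ _)
  pow-+ x (suc a) b = trans (cong (x *_) (pow-+ x a b)) (sym (*-assoc _ _ _))

  pow-2^suc : ∀ x i → pow x (2 ^ suc i) ≡ pow x (2 ^ i) * pow x (2 ^ i)
  pow-2^suc x i = trans (cong (pow x) (cong (2 ^ i ℕ.+_) (ℕ.+-identityʳ (2 ^ i)))) (pow-+ x (2 ^ i) (2 ^ i))

  pow-0# : ∀ {n} → 0 ℕ.< n → pow 0# n ≡ 0#
  pow-0# (ℕ.s≤s _) = zeroˡ _

  sq-+ : ∀ x y → (x + y) * (x + y) ≡ x * x + y * y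
  sq-+ x y = begin
    (x + y) * (x + y)                   ≡⟨ solve 2 (λ x y → ((x :+ y) :* (x :+ y)) ⊜ (x :* x :+ y :* y :+ (x :* y :+ x :* y))) refl x y ⟩
    x * x + y * y + (x * y + x * y)     ≡⟨ cong (x * x + y * y +_) (x+x≡0 (x * y)) ⟩
    x * x + y * y + 0#                  ≡⟨ +-identityʳ _ ⟩
    x * x + y * y                       ∎

  frobenius : ∀ i x y → pow (x + y) (2 ^ i) ≡ pow x (2 ^ i) + pow y (2 ^ i)
  frobenius zero    x y = trans (*-identityʳ _) (sym (cong₂ _+_ (*-identityʳ x) (*-identityʳ y)))
  frobenius (suc i) x y = begin
    pow (x + y) (2 ^ suc i)                               ≡⟨ pow-2^suc (x + y) i ⟩
    pow (x + y) (2 ^ i) * pow (x + y) (2 ^ i)             ≡⟨ cong (λ t → t * t) (frobenius i x y) ⟩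
    (pow x (2 ^ i) + pow y (2 ^ i)) * (pow x (2 ^ i) + pow y (2 ^ i)) ≡⟨ sq-+ _ _ ⟩
    pow x (2 ^ i) * pow x (2 ^ i) + pow y (2 ^ i) * pow y (2 ^ i)   ≡⟨ cong₂ _+_ (pow-2^suc x i) (pow-2^suc y i) ⟨
    pow x (2 ^ suc i) + pow y (2 ^ suc i)                 ∎

  nonzeroPart : Carrier → Carrier
  nonzeroPart x with x ≟ 0#
  ... | yes _ = 1#
  ... | no  _ = x

  nonzeroPart≢0 : ∀ x → nonzeroPart x ≢ 0#
  nonzeroPart≢0 x with x ≟ 0#
  ... | yes _   = 0≢1 ∘ sym
  ... | no  x≢0 = x≢0

  -- With P the product of all x ≢ 0, reindexing by x ↦ a x gives P · a ^ (2 ^ m - 1) = P;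
  -- below 0 is counted as the factor 1 and the missing a is supplied at x = 0.
  fermat : ∀ a → pow a (2 ^ m) ≡ a
  fermat a with a ≟ 0#
  ... | yes refl = pow-0# (ℕ.m^n>0 2 m)
  ... | no  a≢0  = *-cancelˡ (∏≢0 elements nonzeroPart nonzeroPart≢0) (begin
      P * pow a (2 ^ m)                                 ≡⟨ cong (λ n → P * pow a n) size ⟨
      P * pow a (length elements)                       ≡⟨ cong (P *_) (∏-const elements a) ⟨
      P * ∏ elements (λ _ → a)                          ≡⟨ *-comm _ _ ⟩
      ∏ elements (λ _ → a) * P                          ≡⟨ ∏-distrib elements (λ _ → a) nonzeroPart ⟨
      ∏ elements (λ x → a * nonzeroPart x)              ≡⟨ ∏-cong elements scaling ⟨
      ∏ elements (λ x → nonzeroPart (a * x) * a-at-0 x) ≡⟨ ∏-distrib elements _ a-at-0 ⟩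
      ∏ elements (nonzeroPart ∘ (a *_)) * ∏ elements a-at-0
        ≡⟨ cong₂ _*_ (∏-reindex unique complete (a *_) (a ⁻¹ *_) (x⁻¹*[x*y]≡y a≢0) (x*[x⁻¹*y]≡y a≢0) nonzeroPart)
                      (∏-single elements a-at-0 unique (complete 0#) a-at-0-off) ⟩
      P * a-at-0 0#                                     ≡⟨ cong (P *_) a-at-0-at ⟩
      P * a                                             ∎)
    where
    P : Carrier
    P = ∏ elements nonzeroPart
    a-at-0 : Carrier → Carrier
    a-at-0 x with x ≟ 0#
    ... | yes _ = a
    ... | no  _ = 1#
    a-at-0-at : a-at-0 0# ≡ a
    a-at-0-at with 0# ≟ 0#
    ... | yes _   = refl
    ... | no  0≢0 = contradiction refl 0≢0
    a-at-0-off : ∀ {x} → x ∈ elements → x ≢ 0# → a-at-0 x ≡ 1#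
    a-at-0-off {x} _ x≢0 with x ≟ 0#
    ... | yes x≡0 = contradiction x≡0 x≢0
    ... | no  _   = refl
    scaling : ∀ x → nonzeroPart (a * x) * a-at-0 x ≡ a * nonzeroPart x
    scaling x with x ≟ 0# | (a * x) ≟ 0#
    ... | yes refl | yes _    = trans (*-identityˡ a) (sym (*-identityʳ a))
    ... | yes refl | no  a0≢0 = contradiction (zeroʳ a) a0≢0
    ... | no  x≢0  | yes ax≡0 = contradiction ax≡0 (x*y≢0 a≢0 x≢0)
    ... | no  _    | no  _    = *-identityʳ _

  +-cancelʳ : ∀ {x y} z → x + z ≡ y + z → x ≡ y
  +-cancelʳ {x} {y} z eq = trans (sym ([x+y]+y≡x x z)) (trans (cong (_+ z) eq) ([x+y]+y≡x y z))

  bit : Bool → Carrier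
  bit b = if b then 1# else 0#

  Tr-0 : Tr 0# ≡ 0#
  Tr-0 = trans (∑-cong (upTo m) (λ i → pow-0# (ℕ.m^n>0 2 i))) (∑-ε (upTo m))

  Tr-+ : ∀ x y → Tr (x + y) ≡ Tr x + Tr y
  Tr-+ x y = trans (∑-cong (upTo m) (λ i → frobenius i x y)) (∑-distrib (upTo m) _ _)

  Tr-∑ : {I : Set} (xs : List I) (f : I → Carrier) → Tr (∑ xs f) ≡ ∑ xs (Tr ∘ f)
  Tr-∑ = ∑-hom Tr Tr-0 Tr-+

  -- Squaring shifts the Frobenius powers in Tr x by one, and x ^ (2 ^ m) = x closes the cycle.
  Tr-idempotent : ∀ x → Tr x * Tr x ≡ Tr x
  Tr-idempotent x = +-cancelʳ x (begin
    Tr x * Tr x + x                    ≡⟨ +-comm _ x ⟩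
    x + Tr x * Tr x                    ≡⟨ cong₂ _+_ (sym (*-identityʳ x)) (∑-hom (λ t → t * t) (zeroˡ 0#) sq-+ (upTo m) g) ⟩
    g 0 + ∑ (upTo m) (λ i → g i * g i) ≡⟨ cong (g 0 +_) (∑-cong (upTo m) (λ i → sym (pow-2^suc x i))) ⟩
    g 0 + ∑ (upTo m) (g ∘ suc)         ≡⟨ ∑-upTo-rotate m g ⟩
    Tr x + g m                         ≡⟨ cong (Tr x +_) (fermat x) ⟩
    Tr x + x                           ∎)
    where
    g : ℕ → Carrier
    g i = pow x (2 ^ i)

  Tr∈𝔽₂ : ∀ x → Tr x ≡ 0# ⊎ Tr x ≡ 1#
  Tr∈𝔽₂ x with Tr x ≟ 0#
  ... | yes t≡0 = inj₁ t≡0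
  ... | no  t≢0 = inj₂ (x+y≡0⇒x≡y (x*y≡0⇒y≡0 t≢0 (begin
    t * (t + 1#)    ≡⟨ distribˡ t t 1# ⟩
    t * t + t * 1#  ≡⟨ cong₂ _+_ (Tr-idempotent x) (*-identityʳ t) ⟩
    t + t           ≡⟨ x+x≡0 t ⟩
    0#              ∎)))
    where
    t : Carrier
    t = Tr x

  Tr-*-𝔽₂ : ∀ {c} → c ≡ 0# ⊎ c ≡ 1# → ∀ x → Tr (c * x) ≡ c * Tr x
  Tr-*-𝔽₂ (inj₁ refl) x = trans (cong Tr (zeroˡ x)) (trans Tr-0 (sym (zeroˡ _)))
  Tr-*-𝔽₂ (inj₂ refl) x = trans (cong Tr (*-identityˡ x)) (sym (*-identityˡ _))

module Polynomials {m : ℕ} (𝔽 : GF2^ m) where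

  open GF2^ 𝔽
  open Characteristic2Field 𝔽
  open ≡-Reasoning

  eval : List Carrier → Carrier → Carrier
  eval []      x = 0#
  eval (a ∷ p) x = a + x * eval p x

  synthDiv : List Carrier → Carrier → List Carrier
  synthDiv []      r = []
  synthDiv (b ∷ p) r = eval (b ∷ p) r ∷ synthDiv p r

  length-synthDiv : ∀ p r → length (synthDiv p r) ≡ length p
  length-synthDiv []      r = refl
  length-synthDiv (b ∷ p) r = cong suc (length-synthDiv p r)

  eval-synthDiv : ∀ a p r x → eval (a ∷ p) x ≡ (x + r) * eval (synthDiv p r) x + eval (a ∷ p) r
  eval-synthDiv a [] r x = begin
    a + x * 0#                       ≡⟨ a+y*0≡a x ⟩
    a                                ≡⟨ trans (+-identityˡ _) (a+y*0≡a r) ⟨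
    0# + (a + r * 0#)                ≡⟨ cong (_+ (a + r * 0#)) (zeroʳ (x + r)) ⟨
    (x + r) * 0# + (a + r * 0#)      ∎
    where
    a+y*0≡a : ∀ y → a + y * 0# ≡ a
    a+y*0≡a y = trans (cong (a +_) (zeroʳ y)) (+-identityʳ a)
  eval-synthDiv a (b ∷ p) r x = begin
    a + x * eval (b ∷ p) x                          ≡⟨ cong (λ t → a + x * t) (eval-synthDiv b p r x) ⟩
    a + x * ((x + r) * q + c)                       ≡⟨ +-identityʳ _ ⟨
    a + x * ((x + r) * q + c) + 0#                  ≡⟨ cong (a + x * ((x + r) * q + c) +_) (x+x≡0 (r * c)) ⟨
    a + x * ((x + r) * q + c) + (r * c + r * c)
      ≡⟨ solve 5 (λ a x r q c → (a :+ x :* ((x :+ r) :* q :+ c) :+ (r :* c :+ r :* c))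
                                ⊜ ((x :+ r) :* (c :+ x :* q) :+ (a :+ r :* c))) refl a x r q c ⟩
    (x + r) * (c + x * q) + (a + r * c)             ∎
    where
    q c : Carrier
    q = eval (synthDiv p r) x
    c = eval (b ∷ p) r

  head≡0 : ∀ {a p r} → eval p r ≡ 0# → eval (a ∷ p) r ≡ 0# → a ≡ 0#
  head≡0 {a} {p} {r} p[r]≡0 root = begin
    a                 ≡⟨ +-identityʳ a ⟨
    a + 0#            ≡⟨ cong (a +_) (zeroʳ r) ⟨
    a + r * 0#        ≡⟨ cong (λ t → a + r * t) p[r]≡0 ⟨
    a + r * eval p r  ≡⟨ root ⟩
    0#                ∎

  synthDiv-zero : ∀ a p r → All (_≡ 0#) (synthDiv p r) → eval (a ∷ p) r ≡ 0# → All (_≡ 0#) (a ∷ p)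
  synthDiv-zero a []      r []            root = head≡0 {p = []} refl root ∷ []
  synthDiv-zero a (b ∷ p) r (root′ ∷ q≡0) root = head≡0 {p = b ∷ p} root′ root ∷ synthDiv-zero b p r q≡0 root′

  roots-bound : ∀ p (rs : List Carrier) → Unique rs → length p ≤ length rs →
                (∀ {r} → r ∈ rs → eval p r ≡ 0#) → All (_≡ 0#) p
  roots-bound []      rs       _                  _           _     = []
  roots-bound (a ∷ p) (r ∷ rs) (r∉rs ∷ rs-unique) (ℕ.s≤s len) roots =
    synthDiv-zero a p r (roots-bound (synthDiv p r) rs rs-unique (subst (_≤ length rs) (sym (length-synthDiv p r)) len) q-roots)
                        (roots (here refl))
    where
    q-roots : ∀ {r′} → r′ ∈ rs → eval (synthDiv p r) r′ ≡ 0#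
    q-roots {r′} r′∈rs = x*y≡0⇒y≡0 (λ r′+r≡0 → All.lookup r∉rs r′∈rs (sym (x+y≡0⇒x≡y r′+r≡0))) (begin
      (r′ + r) * eval (synthDiv p r) r′                       ≡⟨ +-identityʳ _ ⟨
      (r′ + r) * eval (synthDiv p r) r′ + 0#                  ≡⟨ cong ((r′ + r) * eval (synthDiv p r) r′ +_) (roots (here refl)) ⟨
      (r′ + r) * eval (synthDiv p r) r′ + eval (a ∷ p) r      ≡⟨ eval-synthDiv a p r r′ ⟨
      eval (a ∷ p) r′                                         ≡⟨ roots (there r′∈rs) ⟩
      0#                                                      ∎)

module TraceNondegenerate {m : ℕ} (𝔽 : GF2^ m) where

  open GF2^ 𝔽
  open FieldOps 𝔽
  open Characteristic2Field 𝔽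
  open Polynomials 𝔽
  open ≡-Reasoning

  0<m : 0 < m
  0<m = go m elements size (complete 0#) (complete 1#)
    where
    go : ∀ n (xs : List Carrier) → length xs ≡ 2 ^ n → 0# ∈ xs → 1# ∈ xs → 0 < n
    go (suc n) _       _ _           _           = ℕ.z<s
    go zero    (x ∷ []) _ (here refl) (here 1≡x) = contradiction (sym 1≡x) 0≢1

  2^i<2^m : ∀ {i} → i < m → 2 ^ i < 2 ^ m
  2^i<2^m = ℕ.^-monoʳ-< 2 (ℕ.n<1+n 1)

  eval-tabulate : ∀ n (c : Fin n → Carrier) x → eval (tabulate c) x ≡ ∑ (allFin n) (λ i → c i * pow x (toℕ i))
  eval-tabulate zero    c x = refl
  eval-tabulate (suc n) c x = begin
    c zero + x * eval (tabulate (c ∘ suc)) x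
      ≡⟨ cong (λ t → c zero + x * t) (eval-tabulate n (c ∘ suc) x) ⟩
    c zero + x * ∑ (allFin n) (λ i → c (suc i) * pow x (toℕ i))
      ≡⟨ cong₂ _+_ (sym (*-identityʳ _)) (∑-hom (x *_) (zeroʳ x) (distribˡ x) (allFin n) _) ⟩
    c zero * 1# + ∑ (allFin n) (λ i → x * (c (suc i) * pow x (toℕ i)))
      ≡⟨ cong (c zero * 1# +_) (∑-cong (allFin n) (λ i → x*[y*z]≡y*[x*z] x (c (suc i)) _)) ⟩
    c zero * 1# + ∑ (allFin n) (λ i → c (suc i) * (x * pow x (toℕ i)))
      ≡⟨ ∑-allFin-suc n (λ i → c i * pow x (toℕ i)) ⟨
    ∑ (allFin (suc n)) (λ i → c i * pow x (toℕ i)) ∎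

  -- Coefficients of the trace polynomial X + X² + X⁴ + ⋯ + X^(2^(m-1)), of degree below 2 ^ m.
  trCoeff : Fin (2 ^ m) → Carrier
  trCoeff n = ∑ (upTo m) (λ i → bit (does (toℕ n ℕ.≟ 2 ^ i)))

  eval-trCoeff : ∀ x → eval (tabulate trCoeff) x ≡ Tr x
  eval-trCoeff x = begin
    eval (tabulate trCoeff) x
      ≡⟨ eval-tabulate (2 ^ m) trCoeff x ⟩
    ∑ (allFin (2 ^ m)) (λ n → trCoeff n * pow x (toℕ n))
      ≡⟨ ∑-cong (allFin (2 ^ m)) (λ n → ∑-hom (_* pow x (toℕ n)) (zeroˡ _) (λ a b → distribʳ _ a b) (upTo m) _) ⟩
    ∑ (allFin (2 ^ m)) (λ n → ∑ (upTo m) (λ i → bit (does (toℕ n ℕ.≟ 2 ^ i)) * pow x (toℕ n)))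
      ≡⟨ ∑-comm (allFin (2 ^ m)) (upTo m) _ ⟩
    ∑ (upTo m) (λ i → ∑ (allFin (2 ^ m)) (λ n → bit (does (toℕ n ℕ.≟ 2 ^ i)) * pow x (toℕ n)))
      ≡⟨ ∑-cong-∈ (upTo m) (λ i∈ → monomial (∈-upTo⁻ i∈)) ⟩
    Tr x ∎
    where
    monomial : ∀ {i} → i < m → ∑ (allFin (2 ^ m)) (λ n → bit (does (toℕ n ℕ.≟ 2 ^ i)) * pow x (toℕ n)) ≡ pow x (2 ^ i)
    monomial {i} i<m = begin
      ∑ (allFin (2 ^ m)) (λ n → bit (does (toℕ n ℕ.≟ 2 ^ i)) * pow x (toℕ n))
        ≡⟨ ∑-single (allFin (2 ^ m)) (λ n → bit (does (toℕ n ℕ.≟ 2 ^ i)) * pow x (toℕ n)) (allFin⁺ _) (∈-allFin n₀) off ⟩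
      bit (does (toℕ n₀ ℕ.≟ 2 ^ i)) * pow x (toℕ n₀)
        ≡⟨ cong₂ (λ b e → bit b * pow x e) (dec-true (toℕ n₀ ℕ.≟ 2 ^ i) toℕ-n₀) toℕ-n₀ ⟩
      1# * pow x (2 ^ i)
        ≡⟨ *-identityˡ _ ⟩
      pow x (2 ^ i) ∎
      where
      n₀ : Fin (2 ^ m)
      n₀ = fromℕ< (2^i<2^m i<m)
      toℕ-n₀ : toℕ n₀ ≡ 2 ^ i
      toℕ-n₀ = toℕ-fromℕ< (2^i<2^m i<m)
      off : ∀ {n} → n ∈ allFin (2 ^ m) → n ≢ n₀ → bit (does (toℕ n ℕ.≟ 2 ^ i)) * pow x (toℕ n) ≡ 0#
      off {n} _ n≢n₀ = trans (cong (λ b → bit b * pow x (toℕ n)) (dec-false (toℕ n ℕ.≟ 2 ^ i) n≢2^i)) (zeroˡ _)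
        where
        n≢2^i : toℕ n ≢ 2 ^ i
        n≢2^i eq = n≢n₀ (toℕ-injective (trans eq (sym toℕ-n₀)))

  trCoeff-2^i : ∀ {i} (i<m : i < m) → trCoeff (fromℕ< (2^i<2^m i<m)) ≡ 1#
  trCoeff-2^i {i} i<m = begin
    ∑ (upTo m) (λ j → bit (does (toℕ n ℕ.≟ 2 ^ j)))  ≡⟨ ∑-single (upTo m) _ (upTo⁺ m) (∈-upTo⁺ i<m) off ⟩
    bit (does (toℕ n ℕ.≟ 2 ^ i))                     ≡⟨ cong bit (dec-true (toℕ n ℕ.≟ 2 ^ i) toℕ-n) ⟩
    1#                                               ∎
    where
    n : Fin (2 ^ m)
    n = fromℕ< (2^i<2^m i<m)
    toℕ-n : toℕ n ≡ 2 ^ i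
    toℕ-n = toℕ-fromℕ< (2^i<2^m i<m)
    off : ∀ {j} → j ∈ upTo m → j ≢ i → bit (does (toℕ n ℕ.≟ 2 ^ j)) ≡ 0#
    off {j} _ j≢i = cong bit (dec-false (toℕ n ℕ.≟ 2 ^ j) (λ eq → j≢i (sym (2^-injective (trans (sym toℕ-n) eq)))))

  -- Tr is a nonzero polynomial of degree below 2 ^ m, so it cannot vanish on all 2 ^ m elements.
  Tr-nonzero : ∃ λ x → Tr x ≢ 0#
  Tr-nonzero with any? (λ x → ¬? (Tr x ≟ 0#)) elements
  ... | yes ∃x = satisfied ∃x
  ... | no  ∄x = contradiction (trans (sym (trCoeff-2^i 0<m)) (tabulate⁻ coeffs≡0 (fromℕ< (2^i<2^m 0<m)))) (0≢1 ∘ sym)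
    where
    Tr≡0 : ∀ x → Tr x ≡ 0#
    Tr≡0 x = decidable-stable (Tr x ≟ 0#) (λ Tr≢0 → ∄x (Any.map (λ { refl → Tr≢0 }) (complete x)))
    coeffs≡0 : All (_≡ 0#) (tabulate trCoeff)
    coeffs≡0 = roots-bound (tabulate trCoeff) elements unique
                 (ℕ.≤-reflexive (trans (length-tabulate trCoeff) (sym size)))
                 (λ {r} _ → trans (eval-trCoeff r) (Tr≡0 r))

  Tr-nondegenerate : ∀ {γ} → γ ≢ 0# → ∃ λ z → Tr (γ * z) ≡ 1#
  Tr-nondegenerate {γ} γ≢0 with Tr-nonzero
  ... | x , Tr≢0 with Tr∈𝔽₂ x
  ...   | inj₁ Tr≡0 = contradiction Tr≡0 Tr≢0
  ...   | inj₂ Tr≡1 = γ ⁻¹ * x , trans (cong Tr (x*[x⁻¹*y]≡y γ≢0 x)) Tr≡1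

module TraceDualBasis {m : ℕ} (𝔽 : GF2^ m) where

  open GF2^ 𝔽
  open FieldOps 𝔽
  open Characteristic2Field 𝔽
  open TraceNondegenerate 𝔽 using (Tr-nondegenerate)
  open ≡-Reasoning

  LinIndepF2-tail : ∀ {k} {α : Fin (suc k) → Carrier} → LinIndepF2 (suc k) α → LinIndepF2 k (α ∘ suc)
  LinIndepF2-tail {k} {α} ind s ∑≡0 i =
    ind (false Vector.∷ s) (trans (∑-allFin-suc k _) (trans (+-identityˡ _) ∑≡0)) (suc i)

  Tr-*-+ : ∀ β x y → Tr (β * (x + y)) ≡ Tr (β * x) + Tr (β * y)
  Tr-*-+ β x y = trans (cong Tr (distribˡ β x y)) (Tr-+ _ _)

  bit-Tr : ∀ y → bit (does (Tr y ≟ 1#)) ≡ Tr y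
  bit-Tr y with Tr y ≟ 1# | Tr∈𝔽₂ y
  ... | yes Tr≡1 | _          = sym Tr≡1
  ... | no  _    | inj₁ Tr≡0  = sym Tr≡0
  ... | no  Tr≢1 | inj₂ Tr≡1  = contradiction Tr≡1 Tr≢1

  Tr*bit : ∀ β z b → Tr (β * z) * bit b ≡ Tr ((if b then β else 0#) * z)
  Tr*bit β z true  = *-identityʳ _
  Tr*bit β z false = trans (zeroʳ _) (sym (trans (cong Tr (zeroˡ z)) Tr-0))

  flip-bit : ∀ {t} b → t ≡ 0# ⊎ t ≡ 1# → t ≢ bit b → t + 1# ≡ bit b
  flip-bit true  (inj₁ refl) _   = +-identityˡ 1#
  flip-bit false (inj₁ refl) t≢0 = contradiction refl t≢0
  flip-bit true  (inj₂ refl) t≢1 = contradiction refl t≢1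
  flip-bit false (inj₂ refl) _   = x+x≡0 1#

  -- From a trace-dual basis w of α ∘ suc, independence of α and nondegeneracy of Tr
  -- produce an element trace-dual to α zero and orthogonal to α ∘ suc.
  module DualExtension {k} (α : Fin (suc k) → Carrier) (ind : LinIndepF2 (suc k) α) (w : Fin k → Carrier)
                       (w-dual : ∀ i j → Tr (α (suc i) * w j) ≡ bit (does (i Fin.≟ j))) where

    project : Carrier → Carrier
    project z = z + ∑ (allFin k) (λ j → Tr (α (suc j) * z) * w j)

    Tr-project : ∀ β z → Tr (β * project z) ≡ Tr (β * z) + ∑ (allFin k) (λ j → Tr (α (suc j) * z) * Tr (β * w j))
    Tr-project β z = begin
      Tr (β * project z)
        ≡⟨ Tr-*-+ β z _ ⟩
      Tr (β * z) + Tr (β * ∑ (allFin k) (λ j → c j * w j))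
        ≡⟨ cong (λ t → Tr (β * z) + Tr t) (∑-hom (β *_) (zeroʳ β) (distribˡ β) (allFin k) _) ⟩
      Tr (β * z) + Tr (∑ (allFin k) (λ j → β * (c j * w j)))
        ≡⟨ cong (Tr (β * z) +_) (Tr-∑ (allFin k) _) ⟩
      Tr (β * z) + ∑ (allFin k) (λ j → Tr (β * (c j * w j)))
        ≡⟨ cong (Tr (β * z) +_) (∑-cong (allFin k) (λ j → trans (cong Tr (x*[y*z]≡y*[x*z] β (c j) (w j))) (Tr-*-𝔽₂ (Tr∈𝔽₂ _) _))) ⟩
      Tr (β * z) + ∑ (allFin k) (λ j → c j * Tr (β * w j))  ∎
      where
      c : Fin k → Carrier
      c j = Tr (α (suc j) * z)

    project-orthogonal : ∀ z i → Tr (α (suc i) * project z) ≡ 0#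
    project-orthogonal z i = begin
      Tr (α (suc i) * project z)
        ≡⟨ Tr-project (α (suc i)) z ⟩
      c i + ∑ (allFin k) (λ j → c j * Tr (α (suc i) * w j))
        ≡⟨ cong (c i +_) (∑-single (allFin k) _ (allFin⁺ k) (∈-allFin i) off) ⟩
      c i + c i * Tr (α (suc i) * w i)
        ≡⟨ cong (λ t → c i + c i * t) (trans (w-dual i i) (cong bit (dec-true (i Fin.≟ i) refl))) ⟩
      c i + c i * 1#
        ≡⟨ trans (cong (c i +_) (*-identityʳ (c i))) (x+x≡0 (c i)) ⟩
      0#  ∎
      where
      c : Fin k → Carrier
      c j = Tr (α (suc j) * z)
      off : ∀ {j} → j ∈ allFin k → j ≢ i → c j * Tr (α (suc i) * w j) ≡ 0#
      off {j} _ j≢i = trans (cong (c j *_) (trans (w-dual i j) (cong bit (dec-false (i Fin.≟ j) (j≢i ∘ sym))))) (zeroʳ _)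

    s : Fin k → Bool
    s j = does (Tr (α zero * w j) ≟ 1#)

    γ : Carrier
    γ = α zero + ∑ (allFin k) (λ j → if s j then α (suc j) else 0#)

    γ≢0 : γ ≢ 0#
    γ≢0 γ≡0 with ind (true Vector.∷ s) (trans (∑-allFin-suc k _) γ≡0) zero
    ... | ()

    Tr-α₀-project : ∀ z → Tr (α zero * project z) ≡ Tr (γ * z)
    Tr-α₀-project z = begin
      Tr (α zero * project z)
        ≡⟨ Tr-project (α zero) z ⟩
      Tr (α zero * z) + ∑ (allFin k) (λ j → Tr (α (suc j) * z) * Tr (α zero * w j))
        ≡⟨ cong (Tr (α zero * z) +_) (∑-cong (allFin k) (λ j → trans (cong (_ *_) (sym (bit-Tr _))) (Tr*bit (α (suc j)) z (s j)))) ⟩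
      Tr (α zero * z) + ∑ (allFin k) (λ j → Tr (a j * z))
        ≡⟨ cong (Tr (α zero * z) +_) (Tr-∑ (allFin k) _) ⟨
      Tr (α zero * z) + Tr (∑ (allFin k) (λ j → a j * z))
        ≡⟨ Tr-+ _ _ ⟨
      Tr (α zero * z + ∑ (allFin k) (λ j → a j * z))
        ≡⟨ cong (λ t → Tr (α zero * z + t)) (∑-hom (_* z) (zeroˡ z) (λ x y → distribʳ z x y) (allFin k) a) ⟨
      Tr (α zero * z + ∑ (allFin k) a * z)
        ≡⟨ cong Tr (distribʳ z _ _) ⟨
      Tr (γ * z)  ∎
      where
      a : Fin k → Carrier
      a j = if s j then α (suc j) else 0#

    dual-to-head : ∃ λ d → (∀ i → Tr (α (suc i) * d) ≡ 0#) × Tr (α zero * d) ≡ 1#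
    dual-to-head with Tr-nondegenerate γ≢0
    ... | z , Tr[γz]≡1 = project z , project-orthogonal z , trans (Tr-α₀-project z) Tr[γz]≡1

  trace-surjective : ∀ k (α : Fin k → Carrier) → LinIndepF2 k α →
                     (b : Fin k → Bool) → ∃ λ z → ∀ i → Tr (α i * z) ≡ bit (b i)
  trace-surjective zero    α ind b = 0# , λ ()
  trace-surjective (suc k) α ind b = extend (Tr (α zero * z₀) ≟ bit (b zero))
    where
    surjective-on-tail : (b′ : Fin k → Bool) → ∃ λ z → ∀ i → Tr (α (suc i) * z) ≡ bit (b′ i)
    surjective-on-tail = trace-surjective k (α ∘ suc) (LinIndepF2-tail ind)
    z₀ : Carrier
    z₀ = proj₁ (surjective-on-tail (b ∘ suc))
    z₀-tail : ∀ i → Tr (α (suc i) * z₀) ≡ bit (b (suc i))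
    z₀-tail = proj₂ (surjective-on-tail (b ∘ suc))
    open DualExtension α ind (λ j → proj₁ (surjective-on-tail (λ i → does (i Fin.≟ j))))
                             (λ i j → proj₂ (surjective-on-tail (λ i → does (i Fin.≟ j))) i)
    d : Carrier
    d = proj₁ dual-to-head
    extend : Dec (Tr (α zero * z₀) ≡ bit (b zero)) → ∃ λ z → ∀ i → Tr (α i * z) ≡ bit (b i)
    extend (yes ok) = z₀ , λ { zero → ok ; (suc i) → z₀-tail i }
    extend (no ¬ok) = z₀ + d , λ
      { zero    → trans (Tr-*-+ _ z₀ d) (trans (cong (Tr (α zero * z₀) +_) (proj₂ (proj₂ dual-to-head)))
                                               (flip-bit (b zero) (Tr∈𝔽₂ (α zero * z₀)) ¬ok))
      ; (suc i) → trans (Tr-*-+ _ z₀ d) (trans (cong₂ _+_ (z₀-tail i) (proj₁ (proj₂ dual-to-head) i)) (+-identityʳ _)) }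

module CyclotomicMonomials (k : ℕ) where

  open BigOperators ℤ.+-0-isCommutativeMonoid
  open ≡-Reasoning

  K : ℕ
  K = 2 ^ k

  instance
    K≢0 : ℕ.NonZero K
    K≢0 = ℕ.m^n≢0 2 k

  monoCoeff-at : ∀ e j → toℕ j ≡ e % K → monoCoeff k e j ≡ -1ℤ ℤ.^ (e / K)
  monoCoeff-at e j j≡e%K with toℕ j ℕ.≟ e % K
  ... | no j≢e%K = contradiction j≡e%K j≢e%K
  ... | yes _ with (e / K) % 2 | -1^-parity (e / K)
  ...   | zero  | -1^q≡1  = sym -1^q≡1
  ...   | suc _ | -1^q≡-1 = sym -1^q≡-1

  monoCoeff-off : ∀ e j → toℕ j ≢ e % K → monoCoeff k e j ≡ 0ℤ
  monoCoeff-off e j j≢e%K with toℕ j ℕ.≟ e % K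
  ... | no  _      = refl
  ... | yes j≡e%K = contradiction j≡e%K j≢e%K

  monoCoeff-shift : ∀ e t j → monoCoeff k (e ℕ.+ t ℕ.* K) j ≡ -1ℤ ℤ.^ t ℤ.* monoCoeff k e j
  monoCoeff-shift e t j = by-cases (toℕ j ℕ.≟ e % K)
    where
    [e+tK]/K≡e/K+t : (e ℕ.+ t ℕ.* K) / K ≡ e / K ℕ.+ t
    [e+tK]/K≡e/K+t = trans (+-distrib-/-∣ʳ e (n∣m*n t)) (cong (e / K ℕ.+_) (m*n/n≡m t K))
    by-cases : Dec (toℕ j ≡ e % K) → monoCoeff k (e ℕ.+ t ℕ.* K) j ≡ -1ℤ ℤ.^ t ℤ.* monoCoeff k e j
    by-cases (yes j≡e%K) = begin
      monoCoeff k (e ℕ.+ t ℕ.* K) j        ≡⟨ monoCoeff-at _ j (trans j≡e%K (sym ([m+kn]%n≡m%n e t K))) ⟩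
      -1ℤ ℤ.^ ((e ℕ.+ t ℕ.* K) / K)         ≡⟨ cong (-1ℤ ℤ.^_) [e+tK]/K≡e/K+t ⟩
      -1ℤ ℤ.^ (e / K ℕ.+ t)                 ≡⟨ ℤ.^-distribˡ-+-* -1ℤ (e / K) t ⟩
      -1ℤ ℤ.^ (e / K) ℤ.* -1ℤ ℤ.^ t         ≡⟨ ℤ.*-comm (-1ℤ ℤ.^ (e / K)) _ ⟩
      -1ℤ ℤ.^ t ℤ.* -1ℤ ℤ.^ (e / K)         ≡⟨ cong (-1ℤ ℤ.^ t ℤ.*_) (monoCoeff-at e j j≡e%K) ⟨
      -1ℤ ℤ.^ t ℤ.* monoCoeff k e j         ∎
    by-cases (no j≢e%K) = begin
      monoCoeff k (e ℕ.+ t ℕ.* K) j        ≡⟨ monoCoeff-off _ j (λ eq → j≢e%K (trans eq ([m+kn]%n≡m%n e t K))) ⟩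
      0ℤ                                    ≡⟨ ℤ.*-zeroʳ (-1ℤ ℤ.^ t) ⟨
      -1ℤ ℤ.^ t ℤ.* 0ℤ                      ≡⟨ cong (-1ℤ ℤ.^ t ℤ.*_) (monoCoeff-off e j j≢e%K) ⟨
      -1ℤ ℤ.^ t ℤ.* monoCoeff k e j         ∎

  monoCoeff-0 : ∀ j → monoCoeff k 0 j ≡ coeff (constC {k} 1ℤ) j
  monoCoeff-0 j = by-cases (toℕ j) refl
    where
    0%K≡0 : 0 % K ≡ 0
    0%K≡0 = m<n⇒m%n≡m (ℕ.m^n>0 2 k)
    by-cases : ∀ n → toℕ j ≡ n → monoCoeff k 0 j ≡ (if n ℕ.≡ᵇ 0 then 1ℤ else 0ℤ)
    by-cases zero    j≡0   = trans (monoCoeff-at 0 j (trans j≡0 (sym 0%K≡0))) (cong (-1ℤ ℤ.^_) (0/n≡0 K))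
    by-cases (suc n) j≡1+n = monoCoeff-off 0 j (λ j≡0 → ℕ.0≢1+n (trans (sym (trans j≡0 0%K≡0)) j≡1+n))

  residue : ℕ → Fin K
  residue e = fromℕ< (m%n<n e K)

  ∑-monoCoeff : ∀ (g : Fin K → ℤ) e → ∑ (allFin K) (λ i → g i ℤ.* monoCoeff k e i) ≡ g (residue e) ℤ.* -1ℤ ℤ.^ (e / K)
  ∑-monoCoeff g e = begin
    ∑ (allFin K) (λ i → g i ℤ.* monoCoeff k e i)  ≡⟨ ∑-single (allFin K) _ (allFin⁺ K) (∈-allFin (residue e)) off ⟩
    g (residue e) ℤ.* monoCoeff k e (residue e)   ≡⟨ cong (g (residue e) ℤ.*_) (monoCoeff-at e _ (toℕ-fromℕ< _)) ⟩
    g (residue e) ℤ.* -1ℤ ℤ.^ (e / K)             ∎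
    where
    off : ∀ {i} → i ∈ allFin K → i ≢ residue e → g i ℤ.* monoCoeff k e i ≡ 0ℤ
    off {i} _ i≢r = trans (cong (g i ℤ.*_) (monoCoeff-off e i (λ eq → i≢r (toℕ-injective (trans eq (sym (toℕ-fromℕ< _)))))))
                          (ℤ.*-zeroʳ (g i))

  Antiperiodic : (ℕ → ℤ) → Set
  Antiperiodic h = ∀ x t → h (x ℕ.+ t ℕ.* K) ≡ -1ℤ ℤ.^ t ℤ.* h x

  ∑-monoCoeff-antiperiodic : ∀ h → Antiperiodic h → ∀ e → ∑ (allFin K) (λ i → h (toℕ i) ℤ.* monoCoeff k e i) ≡ h e
  ∑-monoCoeff-antiperiodic h h-anti e = begin
    ∑ (allFin K) (λ i → h (toℕ i) ℤ.* monoCoeff k e i)   ≡⟨ ∑-monoCoeff (h ∘ toℕ) e ⟩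
    h (toℕ (residue e)) ℤ.* -1ℤ ℤ.^ (e / K)              ≡⟨ cong (λ r → h r ℤ.* -1ℤ ℤ.^ (e / K)) (toℕ-fromℕ< _) ⟩
    h (e % K) ℤ.* -1ℤ ℤ.^ (e / K)                        ≡⟨ ℤ.*-comm (h (e % K)) _ ⟩
    -1ℤ ℤ.^ (e / K) ℤ.* h (e % K)                        ≡⟨ h-anti (e % K) (e / K) ⟨
    h (e % K ℕ.+ (e / K) ℕ.* K)                          ≡⟨ cong h (m≡m%n+[m/n]*n e K) ⟨
    h e                                                  ∎

  Antiperiodic-monoCoeff : ∀ c (f : ℕ → ℕ) j → (∀ x t → f (x ℕ.+ t ℕ.* K) ≡ f x ℕ.+ t ℕ.* K) →
                           Antiperiodic (λ x → c ℤ.* monoCoeff k (f x) j)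
  Antiperiodic-monoCoeff c f j f-shift x t = begin
    c ℤ.* monoCoeff k (f (x ℕ.+ t ℕ.* K)) j           ≡⟨ cong (λ e → c ℤ.* monoCoeff k e j) (f-shift x t) ⟩
    c ℤ.* monoCoeff k (f x ℕ.+ t ℕ.* K) j             ≡⟨ cong (c ℤ.*_) (monoCoeff-shift (f x) t j) ⟩
    c ℤ.* (-1ℤ ℤ.^ t ℤ.* monoCoeff k (f x) j)         ≡⟨ x∙yz≈y∙xz c (-1ℤ ℤ.^ t) (monoCoeff k (f x) j) ⟩
    -1ℤ ℤ.^ t ℤ.* (c ℤ.* monoCoeff k (f x) j)         ∎

  IsMonomial : Cyc k → ℤ → ℕ → Set
  IsMonomial a n e = ∀ j → coeff a j ≡ n ℤ.* monoCoeff k e j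

  coeff-sumC : ∀ (xs : List (Cyc k)) j → coeff (sumC xs) j ≡ ∑ xs (λ a → coeff a j)
  coeff-sumC []       j = refl
  coeff-sumC (a ∷ xs) j = cong (λ t → coeff a j ℤ.+ t) (coeff-sumC xs j)

  coeff-⊗ : ∀ (a b : Cyc k) j → coeff (a ⊗ b) j ≡
            ∑ (allFin K) (λ i → ∑ (allFin K) (λ i′ → (coeff a i ℤ.* coeff b i′) ℤ.* monoCoeff k (toℕ i ℕ.+ toℕ i′) j))
  coeff-⊗ a b j = begin
    coeff (a ⊗ b) j                                              ≡⟨ coeff-sumC (concatMap terms (allFin K)) j ⟩
    ∑ (concatMap terms (allFin K)) (λ c → coeff c j)             ≡⟨ ∑-concatMap terms (allFin K) (λ c → coeff c j) ⟩
    ∑ (allFin K) (λ i → ∑ (terms i) (λ c → coeff c j))           ≡⟨ ∑-cong (allFin K) (λ i → ∑-map (term i) (allFin K) (λ c → coeff c j)) ⟩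
    ∑ (allFin K) (λ i → ∑ (allFin K) (λ i′ → coeff (term i i′) j)) ∎
    where
    term : Fin K → Fin K → Cyc k
    term i i′ = scale (coeff a i ℤ.* coeff b i′) (mono k (toℕ i ℕ.+ toℕ i′))
    terms : Fin K → List (Cyc k)
    terms i = map (term i) (allFin K)

  ⊗-monomial : ∀ {a b n n′ e e′} → IsMonomial a n e → IsMonomial b n′ e′ → IsMonomial (a ⊗ b) (n ℤ.* n′) (e ℕ.+ e′)
  ⊗-monomial {a} {b} {n} {n′} {e} {e′} a≈ b≈ j = begin
    coeff (a ⊗ b) j
      ≡⟨ coeff-⊗ a b j ⟩
    ∑ (allFin K) (λ i → ∑ (allFin K) (λ i′ → (coeff a i ℤ.* coeff b i′) ℤ.* monoCoeff k (toℕ i ℕ.+ toℕ i′) j))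
      ≡⟨ ∑-cong (allFin K) (λ i → ∑-cong (allFin K) (λ i′ → reorder i i′)) ⟩
    ∑ (allFin K) (λ i → ∑ (allFin K) (λ i′ → inner i (toℕ i′) ℤ.* monoCoeff k e′ i′))
      ≡⟨ ∑-cong (allFin K) (λ i → ∑-monoCoeff-antiperiodic (inner i) (inner-antiperiodic i) e′) ⟩
    ∑ (allFin K) (λ i → inner i e′)
      ≡⟨ ∑-cong (allFin K) (λ i → xy∙z≈xz∙y (n ℤ.* n′) _ _) ⟩
    ∑ (allFin K) (λ i → outer (toℕ i) ℤ.* monoCoeff k e i)
      ≡⟨ ∑-monoCoeff-antiperiodic outer outer-antiperiodic e ⟩
    outer e ∎
    where
    inner : Fin K → ℕ → ℤ
    inner i x = n ℤ.* n′ ℤ.* monoCoeff k e i ℤ.* monoCoeff k (toℕ i ℕ.+ x) j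
    inner-antiperiodic : ∀ i → Antiperiodic (inner i)
    inner-antiperiodic i = Antiperiodic-monoCoeff (n ℤ.* n′ ℤ.* monoCoeff k e i) (toℕ i ℕ.+_) j (λ x t → sym (ℕ.+-assoc (toℕ i) x _))
    +-swap : ∀ x y z → x ℕ.+ y ℕ.+ z ≡ x ℕ.+ z ℕ.+ y
    +-swap = ℕ-solve
    outer : ℕ → ℤ
    outer x = n ℤ.* n′ ℤ.* monoCoeff k (x ℕ.+ e′) j
    outer-antiperiodic : Antiperiodic outer
    outer-antiperiodic = Antiperiodic-monoCoeff (n ℤ.* n′) (ℕ._+ e′) j (λ x t → +-swap x (t ℕ.* K) e′)
    regroup : ∀ n μ n′ ν ρ → (n ℤ.* μ ℤ.* (n′ ℤ.* ν)) ℤ.* ρ ≡ n ℤ.* n′ ℤ.* μ ℤ.* ρ ℤ.* ν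
    regroup = ℤ-solve
    reorder : ∀ i i′ → (coeff a i ℤ.* coeff b i′) ℤ.* monoCoeff k (toℕ i ℕ.+ toℕ i′) j ≡ inner i (toℕ i′) ℤ.* monoCoeff k e′ i′
    reorder i i′ = begin
      (coeff a i ℤ.* coeff b i′) ℤ.* monoCoeff k (toℕ i ℕ.+ toℕ i′) j
        ≡⟨ cong₂ (λ x y → (x ℤ.* y) ℤ.* monoCoeff k (toℕ i ℕ.+ toℕ i′) j) (a≈ i) (b≈ i′) ⟩
      (n ℤ.* monoCoeff k e i ℤ.* (n′ ℤ.* monoCoeff k e′ i′)) ℤ.* monoCoeff k (toℕ i ℕ.+ toℕ i′) j
        ≡⟨ regroup n _ n′ _ _ ⟩
      inner i (toℕ i′) ℤ.* monoCoeff k e′ i′ ∎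

  -- e + conjExp e is a multiple of 2 K, the order of X, so X ^ conjExp e is the conjugate of X ^ e.
  conjExp : ℕ → ℕ
  conjExp e = 2 ℕ.* K ℕ.∸ e % K ℕ.+ (e / K) ℕ.* K

  conj-monomial : ∀ {a n e} → IsMonomial a n e → IsMonomial (conj a) n (conjExp e)
  conj-monomial {a} {n} {e} a≈ j = begin
    coeff (conj a) j
      ≡⟨ coeff-sumC (map term (allFin K)) j ⟩
    ∑ (map term (allFin K)) (λ c → coeff c j)
      ≡⟨ ∑-map term (allFin K) (λ c → coeff c j) ⟩
    ∑ (allFin K) (λ i → coeff a i ℤ.* monoCoeff k (2 ℕ.* K ℕ.∸ toℕ i) j)
      ≡⟨ ∑-cong (allFin K) (λ i → trans (cong (ℤ._* _) (a≈ i)) (xy∙z≈xz∙y n _ _)) ⟩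
    ∑ (allFin K) (λ i → n ℤ.* monoCoeff k (2 ℕ.* K ℕ.∸ toℕ i) j ℤ.* monoCoeff k e i)
      ≡⟨ ∑-monoCoeff (λ i → n ℤ.* monoCoeff k (2 ℕ.* K ℕ.∸ toℕ i) j) e ⟩
    n ℤ.* monoCoeff k (2 ℕ.* K ℕ.∸ toℕ (residue e)) j ℤ.* -1ℤ ℤ.^ (e / K)
      ≡⟨ cong (λ r → n ℤ.* monoCoeff k (2 ℕ.* K ℕ.∸ r) j ℤ.* -1ℤ ℤ.^ (e / K)) (toℕ-fromℕ< (m%n<n e K)) ⟩
    n ℤ.* monoCoeff k (2 ℕ.* K ℕ.∸ e % K) j ℤ.* -1ℤ ℤ.^ (e / K)
      ≡⟨ xy∙z≈x∙zy n _ _ ⟩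
    n ℤ.* (-1ℤ ℤ.^ (e / K) ℤ.* monoCoeff k (2 ℕ.* K ℕ.∸ e % K) j)
      ≡⟨ cong (n ℤ.*_) (monoCoeff-shift _ (e / K) j) ⟨
    n ℤ.* monoCoeff k (conjExp e) j ∎
    where
    term : Fin K → Cyc k
    term i = scale (coeff a i) (mono k (2 ℕ.* K ℕ.∸ toℕ i))

  +-conjExp : ∀ e → e ℕ.+ conjExp e ≡ 0 ℕ.+ (2 ℕ.* suc (e / K)) ℕ.* K
  +-conjExp e = begin
    e ℕ.+ conjExp e                                       ≡⟨ cong (ℕ._+ conjExp e) (m≡m%n+[m/n]*n e K) ⟩
    (r ℕ.+ q ℕ.* K) ℕ.+ ((2 ℕ.* K ℕ.∸ r) ℕ.+ q ℕ.* K)     ≡⟨ regroup r (2 ℕ.* K ℕ.∸ r) q K ⟩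
    (r ℕ.+ (2 ℕ.* K ℕ.∸ r)) ℕ.+ 2 ℕ.* q ℕ.* K              ≡⟨ cong (ℕ._+ 2 ℕ.* q ℕ.* K) (ℕ.m+[n∸m]≡n r≤2K) ⟩
    2 ℕ.* K ℕ.+ 2 ℕ.* q ℕ.* K                              ≡⟨ factor q K ⟩
    0 ℕ.+ (2 ℕ.* suc q) ℕ.* K                              ∎
    where
    r q : ℕ
    r = e % K
    q = e / K
    r≤2K : r ≤ 2 ℕ.* K
    r≤2K = ℕ.≤-trans (ℕ.<⇒≤ (m%n<n e K)) (ℕ.m≤m+n K (K ℕ.+ 0))
    regroup : ∀ r d q K → (r ℕ.+ q ℕ.* K) ℕ.+ (d ℕ.+ q ℕ.* K) ≡ (r ℕ.+ d) ℕ.+ 2 ℕ.* q ℕ.* K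
    regroup = ℕ-solve
    factor : ∀ q K → 2 ℕ.* K ℕ.+ 2 ℕ.* q ℕ.* K ≡ 0 ℕ.+ (2 ℕ.* suc q) ℕ.* K
    factor = ℕ-solve

  monomial-AbsEq : ∀ {a n e} → IsMonomial a (ℤ.+ n) e → AbsEq a n
  monomial-AbsEq {a} {n} {e} a≈ j = begin
    coeff (a ⊗ conj a) j                                         ≡⟨ ⊗-monomial {n = ℤ.+ n} {ℤ.+ n} {e} {conjExp e} a≈ (conj-monomial {a} {ℤ.+ n} {e} a≈) j ⟩
    n² ℤ.* monoCoeff k (e ℕ.+ conjExp e) j                       ≡⟨ cong (λ x → n² ℤ.* monoCoeff k x j) (+-conjExp e) ⟩
    n² ℤ.* monoCoeff k (0 ℕ.+ t ℕ.* K) j                         ≡⟨ cong (n² ℤ.*_) (monoCoeff-shift 0 t j) ⟩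
    n² ℤ.* (-1ℤ ℤ.^ t ℤ.* monoCoeff k 0 j)                      ≡⟨ cong (λ s → n² ℤ.* (s ℤ.* monoCoeff k 0 j)) (-1^[2*t]≡1 (suc (e / K))) ⟩
    n² ℤ.* (1ℤ ℤ.* monoCoeff k 0 j)                             ≡⟨ cong (n² ℤ.*_) (trans (ℤ.*-identityˡ _) (monoCoeff-0 j)) ⟩
    n² ℤ.* coeff (constC {k} 1ℤ) j                              ≡⟨ cong (ℤ._* coeff (constC {k} 1ℤ) j) (ℤ.pos-* n n) ⟨
    ℤ.+ (n ℕ.* n) ℤ.* coeff (constC {k} 1ℤ) j                     ≡⟨ scale-indicator (ℤ.+ (n ℕ.* n)) (toℕ j ℕ.≡ᵇ 0) ⟩
    coeff (constC {k} (ℤ.+ (n ℕ.* n))) j                          ∎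
    where
    n² : ℤ
    n² = ℤ.+ n ℤ.* ℤ.+ n
    t : ℕ
    t = 2 ℕ.* suc (e / K)
    scale-indicator : ∀ c b → c ℤ.* (if b then 1ℤ else 0ℤ) ≡ (if b then c else 0ℤ)
    scale-indicator c true  = ℤ.*-identityʳ c
    scale-indicator c false = ℤ.*-zeroʳ c

module AdditiveCharacter {m : ℕ} (𝔽 : GF2^ m) where

  open GF2^ 𝔽
  open FieldOps 𝔽
  open Characteristic2Field 𝔽 using (Tr-0; Tr-+; Tr∈𝔽₂; [x+y]+y≡x; x+x≡0; +-identityˡ; +-identityʳ; zeroˡ; distribˡ)
  open TraceNondegenerate 𝔽 using (Tr-nondegenerate)
  open BigOperators ℤ.+-0-isCommutativeMonoid
  open ≡-Reasoning

  χ : Carrier → ℤ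
  χ t = sign (toBit (Tr t))

  toBit-0# : toBit 0# ≡ 0
  toBit-0# with 0# ≟ 0#
  ... | yes _   = refl
  ... | no  0≢0 = contradiction refl 0≢0

  toBit-1# : toBit 1# ≡ 1
  toBit-1# with 1# ≟ 0#
  ... | yes 1≡0 = contradiction (sym 1≡0) 0≢1
  ... | no  _   = refl

  χ-Tr≡0 : ∀ {t} → Tr t ≡ 0# → χ t ≡ 1ℤ
  χ-Tr≡0 Tr≡0 = cong sign (trans (cong toBit Tr≡0) toBit-0#)

  χ-Tr≡1 : ∀ {t} → Tr t ≡ 1# → χ t ≡ -1ℤ
  χ-Tr≡1 Tr≡1 = cong sign (trans (cong toBit Tr≡1) toBit-1#)

  Tr[a+b]≡ : ∀ {a b s t r} → Tr a ≡ s → Tr b ≡ t → s + t ≡ r → Tr (a + b) ≡ r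
  Tr[a+b]≡ {a} {b} Tra Trb s+t≡r = trans (Tr-+ a b) (trans (cong₂ _+_ Tra Trb) s+t≡r)

  χ-+ : ∀ a b → χ (a + b) ≡ χ a ℤ.* χ b
  χ-+ a b with Tr∈𝔽₂ a | Tr∈𝔽₂ b
  ... | inj₁ a₀ | inj₁ b₀ = trans (χ-Tr≡0 (Tr[a+b]≡ a₀ b₀ (+-identityˡ 0#))) (sym (cong₂ ℤ._*_ (χ-Tr≡0 a₀) (χ-Tr≡0 b₀)))
  ... | inj₁ a₀ | inj₂ b₁ = trans (χ-Tr≡1 (Tr[a+b]≡ a₀ b₁ (+-identityˡ 1#))) (sym (cong₂ ℤ._*_ (χ-Tr≡0 a₀) (χ-Tr≡1 b₁)))
  ... | inj₂ a₁ | inj₁ b₀ = trans (χ-Tr≡1 (Tr[a+b]≡ a₁ b₀ (+-identityʳ 1#))) (sym (cong₂ ℤ._*_ (χ-Tr≡1 a₁) (χ-Tr≡0 b₀)))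
  ... | inj₂ a₁ | inj₂ b₁ = trans (χ-Tr≡0 (Tr[a+b]≡ a₁ b₁ (x+x≡0 1#)))      (sym (cong₂ ℤ._*_ (χ-Tr≡1 a₁) (χ-Tr≡1 b₁)))

  i≡-i⇒i≡0 : ∀ {i} → i ≡ ℤ.- i → i ≡ 0ℤ
  i≡-i⇒i≡0 {ℤ.+ zero} _ = refl

  ∑-negated-by-translation : ∀ w (f : Carrier → ℤ) → (∀ z → f (z + w) ≡ ℤ.- f z) → ∑ elements f ≡ 0ℤ
  ∑-negated-by-translation w f negated = i≡-i⇒i≡0 (begin
    ∑ elements f                  ≡⟨ ∑-reindex unique complete (_+ w) (_+ w) (λ z → [x+y]+y≡x z w) (λ z → [x+y]+y≡x z w) f ⟨
    ∑ elements (λ z → f (z + w))  ≡⟨ ∑-cong elements negated ⟩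
    ∑ elements (λ z → ℤ.- f z)    ≡⟨ ∑-hom ℤ.-_ refl ℤ.neg-distrib-+ elements f ⟨
    ℤ.- ∑ elements f              ∎)

  ∑-1 : {I : Set} (xs : List I) → ∑ xs (λ _ → 1ℤ) ≡ ℤ.+ length xs
  ∑-1 []       = refl
  ∑-1 (x ∷ xs) = cong (λ t → 1ℤ ℤ.+ t) (∑-1 xs)

  characterSum : Carrier → ℤ
  characterSum γ = ∑ elements (λ y → χ (γ * y))

  characterSum-0# : characterSum 0# ≡ ℤ.+ (2 ^ m)
  characterSum-0# = begin
    ∑ elements (λ y → χ (0# * y))  ≡⟨ ∑-cong elements (λ y → χ-Tr≡0 (trans (cong Tr (zeroˡ y)) Tr-0)) ⟩
    ∑ elements (λ _ → 1ℤ)          ≡⟨ ∑-1 elements ⟩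
    ℤ.+ length elements            ≡⟨ cong ℤ.+_ size ⟩
    ℤ.+ (2 ^ m)                    ∎

  characterSum-≢0 : ∀ {γ} → γ ≢ 0# → characterSum γ ≡ 0ℤ
  characterSum-≢0 {γ} γ≢0 with Tr-nondegenerate γ≢0
  ... | z , Tr[γz]≡1 = ∑-negated-by-translation z (λ y → χ (γ * y)) λ y → begin
    χ (γ * (y + z))            ≡⟨ cong χ (distribˡ γ y z) ⟩
    χ (γ * y + γ * z)          ≡⟨ χ-+ _ _ ⟩
    χ (γ * y) ℤ.* χ (γ * z)    ≡⟨ cong (χ (γ * y) ℤ.*_) (χ-Tr≡1 Tr[γz]≡1) ⟩
    χ (γ * y) ℤ.* -1ℤ          ≡⟨ ℤ.*-comm _ -1ℤ ⟩
    -1ℤ ℤ.* χ (γ * y)          ≡⟨ ℤ.-1*i≡-i _ ⟩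
    ℤ.- χ (γ * y)              ∎

module WalshSpectrum {m : ℕ} (𝔽 : GF2^ m) (k : ℕ) (α : Fin k → GF2^.Carrier 𝔽) (ind : FieldOps.LinIndepF2 𝔽 k α) where

  open GF2^ 𝔽
  open FieldOps 𝔽
  open Bent 𝔽
  open Characteristic2Field 𝔽
    using ( +-identityˡ; +-identityʳ; *-assoc; *-comm; *-identityʳ; zeroˡ; zeroʳ; distribˡ; [x*y]*[z*w]≡[x*z]*[y*w]
          ; x+x≡0; [x+y]+y≡x; x+y≡0⇒x≡y; x⁻¹*[x*y]≡y; x*[x⁻¹*y]≡y; Tr-0; Tr∈𝔽₂; bit)
  open TraceDualBasis 𝔽 using (trace-surjective)
  open AdditiveCharacter 𝔽
  open CyclotomicMonomials k
  open BigOperators ℤ.+-0-isCommutativeMonoid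
  module ℕΣ = BigOperators ℕ.+-0-isCommutativeMonoid
  open ≡-Reasoning

  ∑-*ˡ : {I : Set} (a : ℤ) (xs : List I) (f : I → ℤ) → a ℤ.* ∑ xs f ≡ ∑ xs (λ x → a ℤ.* f x)
  ∑-*ˡ a = ∑-hom (a ℤ.*_) (ℤ.*-zeroʳ a) (ℤ.*-distribˡ-+ a)

  ∑-*ʳ : {I : Set} (a : ℤ) (xs : List I) (f : I → ℤ) → ∑ xs f ℤ.* a ≡ ∑ xs (λ x → f x ℤ.* a)
  ∑-*ʳ a = ∑-hom (ℤ._* a) (ℤ.*-zeroˡ a) (λ x y → ℤ.*-distribʳ-+ a x y)

  F : Carrier → Carrier → ℕ
  F = Fα k α

  G : Carrier → ℕ
  G z = ℕΣ.∑ (allFin k) (λ i → 2 ^ toℕ i ℕ.* toBit (Tr (α i * z)))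

  πα-0# : ∀ a → πα a 0# ≡ 0#
  πα-0# a with 0# ≟ 0#
  ... | yes _   = refl
  ... | no  0≢0 = contradiction refl 0≢0

  πα-≢0 : ∀ a {y} → y ≢ 0# → πα a y ≡ a * y ⁻¹
  πα-≢0 a {y} y≢0 with y ≟ 0#
  ... | yes y≡0 = contradiction y≡0 y≢0
  ... | no  _   = refl

  F-0# : ∀ x → F x 0# ≡ 0
  F-0# x = trans (ℕΣ.∑-cong (allFin k) vanishes) (ℕΣ.∑-ε (allFin k))
    where
    vanishes : ∀ i → 2 ^ toℕ i ℕ.* toBit (Tr (x * πα (α i) 0#)) ≡ 0
    vanishes i = begin
      2 ^ toℕ i ℕ.* toBit (Tr (x * πα (α i) 0#))  ≡⟨ cong (λ t → 2 ^ toℕ i ℕ.* toBit (Tr t)) (trans (cong (x *_) (πα-0# (α i))) (zeroʳ x)) ⟩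
      2 ^ toℕ i ℕ.* toBit (Tr 0#)                 ≡⟨ cong (λ t → 2 ^ toℕ i ℕ.* toBit t) Tr-0 ⟩
      2 ^ toℕ i ℕ.* toBit 0#                      ≡⟨ cong (2 ^ toℕ i ℕ.*_) toBit-0# ⟩
      2 ^ toℕ i ℕ.* 0                             ≡⟨ ℕ.*-zeroʳ (2 ^ toℕ i) ⟩
      0                                           ∎

  F-scaled : ∀ z {y} → y ≢ 0# → F (z * y) y ≡ G z
  F-scaled z {y} y≢0 = ℕΣ.∑-cong (allFin k) λ i → cong (λ t → 2 ^ toℕ i ℕ.* toBit (Tr t)) (begin
    (z * y) * πα (α i) y      ≡⟨ cong ((z * y) *_) (πα-≢0 (α i) y≢0) ⟩
    (z * y) * (α i * y ⁻¹)    ≡⟨ [x*y]*[z*w]≡[x*z]*[y*w] z y (α i) (y ⁻¹) ⟩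
    (z * α i) * (y * y ⁻¹)    ≡⟨ cong (_* (y * y ⁻¹)) (*-comm z (α i)) ⟩
    (α i * z) * (y * y ⁻¹)    ≡⟨ cong ((α i * z) *_) (inverseʳ y y≢0) ⟩
    (α i * z) * 1#            ≡⟨ *-identityʳ _ ⟩
    α i * z                   ∎)

  G-translate : ∀ l w → (∀ i → Tr (α i * w) ≡ bit (does (i Fin.≟ l))) →
                ∀ z → Tr (α l * z) ≡ 0# → G (z + w) ≡ G z ℕ.+ 2 ^ toℕ l
  G-translate l w w-dual z Tr[αz]≡0 = begin
    G (z + w)                                       ≡⟨ ℕΣ.∑-cong (allFin k) flip-at-l ⟩
    ℕΣ.∑ (allFin k) (λ i → g i ℕ.+ δ i)             ≡⟨ ℕΣ.∑-distrib (allFin k) g δ ⟩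
    G z ℕ.+ ℕΣ.∑ (allFin k) δ                       ≡⟨ cong (G z ℕ.+_) (ℕΣ.∑-single (allFin k) δ (allFin⁺ k) (∈-allFin l) δ-off) ⟩
    G z ℕ.+ δ l                                     ≡⟨ cong (λ b → G z ℕ.+ (if b then 2 ^ toℕ l else 0)) (dec-true (l Fin.≟ l) refl) ⟩
    G z ℕ.+ 2 ^ toℕ l                               ∎
    where
    g δ : Fin k → ℕ
    g i = 2 ^ toℕ i ℕ.* toBit (Tr (α i * z))
    δ i = if does (i Fin.≟ l) then 2 ^ toℕ l else 0
    δ-off : ∀ {i} → i ∈ allFin k → i ≢ l → δ i ≡ 0
    δ-off {i} _ i≢l = cong (λ b → if b then 2 ^ toℕ l else 0) (dec-false (i Fin.≟ l) i≢l)
    Tr-α-translate : ∀ {i t r} → Tr (α i * w) ≡ t → Tr (α i * z) + t ≡ r → Tr (α i * (z + w)) ≡ r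
    Tr-α-translate {i} Tr[αw]≡t = trans (cong Tr (distribˡ (α i) z w)) ∘ Tr[a+b]≡ refl Tr[αw]≡t
    flip-at-l : ∀ i → 2 ^ toℕ i ℕ.* toBit (Tr (α i * (z + w))) ≡ g i ℕ.+ δ i
    flip-at-l i with i Fin.≟ l | w-dual i
    ... | yes refl | Tr[αw]≡1 = begin
      2 ^ toℕ i ℕ.* toBit (Tr (α i * (z + w)))
        ≡⟨ cong (λ t → 2 ^ toℕ i ℕ.* toBit t) (Tr-α-translate Tr[αw]≡1 (trans (cong (_+ 1#) Tr[αz]≡0) (+-identityˡ 1#))) ⟩
      2 ^ toℕ i ℕ.* toBit 1#
        ≡⟨ cong (2 ^ toℕ i ℕ.*_) toBit-1# ⟩
      2 ^ toℕ i ℕ.* 1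
        ≡⟨ trans (ℕ.*-identityʳ _) (sym (cong (ℕ._+ 2 ^ toℕ i) (ℕ.*-zeroʳ (2 ^ toℕ i)))) ⟩
      2 ^ toℕ i ℕ.* 0 ℕ.+ 2 ^ toℕ i
        ≡⟨ cong (λ b → 2 ^ toℕ i ℕ.* b ℕ.+ 2 ^ toℕ i) (trans (cong toBit Tr[αz]≡0) toBit-0#) ⟨
      g i ℕ.+ 2 ^ toℕ i ∎
    ... | no  _    | Tr[αw]≡0 = begin
      2 ^ toℕ i ℕ.* toBit (Tr (α i * (z + w)))
        ≡⟨ cong (λ t → 2 ^ toℕ i ℕ.* toBit t) (Tr-α-translate Tr[αw]≡0 (+-identityʳ _)) ⟩
      g i
        ≡⟨ ℕ.+-identityʳ (g i) ⟨
      g i ℕ.+ 0 ∎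

  ζ^cG : ℕ → Fin K → Carrier → ℤ
  ζ^cG c j z = monoCoeff k (2 ℕ.* (c ℕ.* G z)) j

  -- With 2 c 2 ^ l an odd multiple of K, translating z by the element trace-dual to α l
  -- shifts the exponent 2 c G z by an odd multiple of K, which negates X ^ (2 c G z).
  ∑-ζ^cG : ∀ c → 0 < c → c < K → ∀ j → ∑ elements (ζ^cG c j) ≡ 0ℤ
  ∑-ζ^cG c 0<c c<K j with odd-multiple-of-2^k k c 0<c c<K
  ... | l , l<k , s , 2c2^l≡odd*K = ∑-negated-by-translation w (ζ^cG c j) negated
    where
    l′ : Fin k
    l′ = fromℕ< l<k
    dual : ∃ λ w → ∀ i → Tr (α i * w) ≡ bit (does (i Fin.≟ l′))
    dual = trace-surjective k α ind (λ i → does (i Fin.≟ l′))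
    w : Carrier
    w = proj₁ dual
    negated₀ : ∀ z → Tr (α l′ * z) ≡ 0# → ζ^cG c j (z + w) ≡ ℤ.- ζ^cG c j z
    negated₀ z Tr≡0 = begin
      monoCoeff k (2 ℕ.* (c ℕ.* G (z + w))) j
        ≡⟨ cong (λ n → monoCoeff k (2 ℕ.* (c ℕ.* n)) j) (G-translate l′ w (proj₂ dual) z Tr≡0) ⟩
      monoCoeff k (2 ℕ.* (c ℕ.* (G z ℕ.+ 2 ^ toℕ l′))) j
        ≡⟨ cong (λ n → monoCoeff k n j) (shift (G z)) ⟩
      monoCoeff k (2 ℕ.* (c ℕ.* G z) ℕ.+ suc (2 ℕ.* s) ℕ.* K) j
        ≡⟨ monoCoeff-shift _ (suc (2 ℕ.* s)) j ⟩
      -1ℤ ℤ.^ suc (2 ℕ.* s) ℤ.* ζ^cG c j z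
        ≡⟨ cong (ℤ._* ζ^cG c j z) (-1^[1+2*t]≡-1 s) ⟩
      -1ℤ ℤ.* ζ^cG c j z
        ≡⟨ ℤ.-1*i≡-i _ ⟩
      ℤ.- ζ^cG c j z ∎
      where
      shift : ∀ g → 2 ℕ.* (c ℕ.* (g ℕ.+ 2 ^ toℕ l′)) ≡ 2 ℕ.* (c ℕ.* g) ℕ.+ suc (2 ℕ.* s) ℕ.* K
      shift g = begin
        2 ℕ.* (c ℕ.* (g ℕ.+ 2 ^ toℕ l′))              ≡⟨ cong (2 ℕ.*_) (ℕ.*-distribˡ-+ c g _) ⟩
        2 ℕ.* (c ℕ.* g ℕ.+ c ℕ.* 2 ^ toℕ l′)          ≡⟨ ℕ.*-distribˡ-+ 2 (c ℕ.* g) _ ⟩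
        2 ℕ.* (c ℕ.* g) ℕ.+ 2 ℕ.* (c ℕ.* 2 ^ toℕ l′)  ≡⟨ cong (λ n → 2 ℕ.* (c ℕ.* g) ℕ.+ 2 ℕ.* (c ℕ.* 2 ^ n)) (toℕ-fromℕ< l<k) ⟩
        2 ℕ.* (c ℕ.* g) ℕ.+ 2 ℕ.* (c ℕ.* 2 ^ l)       ≡⟨ cong (2 ℕ.* (c ℕ.* g) ℕ.+_) 2c2^l≡odd*K ⟩
        2 ℕ.* (c ℕ.* g) ℕ.+ suc (2 ℕ.* s) ℕ.* K       ∎
    negated : ∀ z → ζ^cG c j (z + w) ≡ ℤ.- ζ^cG c j z
    negated z with Tr∈𝔽₂ (α l′ * z)
    ... | inj₁ Tr≡0 = negated₀ z Tr≡0
    ... | inj₂ Tr≡1 = begin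
      ζ^cG c j (z + w)                     ≡⟨ ℤ.neg-involutive _ ⟨
      ℤ.- ℤ.- ζ^cG c j (z + w)             ≡⟨ cong ℤ.-_ (negated₀ (z + w) Tr[α[z+w]]≡0) ⟨
      ℤ.- ζ^cG c j ((z + w) + w)           ≡⟨ cong (λ x → ℤ.- ζ^cG c j x) ([x+y]+y≡x z w) ⟩
      ℤ.- ζ^cG c j z                       ∎
      where
      Tr[α[z+w]]≡0 : Tr (α l′ * (z + w)) ≡ 0#
      Tr[α[z+w]]≡0 = trans (cong Tr (distribˡ (α l′) z w))
                           (Tr[a+b]≡ Tr≡1 (trans (proj₂ dual l′) (cong bit (dec-true (l′ Fin.≟ l′) refl))) (x+x≡0 1#))

  -- The summand of walsh is local to its where block; this gives it a name.
  walsh-summand : ∀ c u₁ u₂ → Σ (Carrier × Carrier → Cyc k) λ t → walsh k F c u₁ u₂ ≡ sumC (map t pairs)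
  walsh-summand c u₁ u₂ = _ , refl

  coeff-walsh-summand : ∀ c u₁ u₂ x y j →
    coeff (proj₁ (walsh-summand c u₁ u₂) (x , y)) j ≡ χ (u₁ * x + u₂ * y) ℤ.* monoCoeff k (2 ℕ.* (c ℕ.* F x y)) j
  coeff-walsh-summand c u₁ u₂ x y j with toBit (Tr (u₁ * x + u₂ * y))
  ... | zero  = refl
  ... | suc _ = refl

  coeff-walsh : ∀ c u₁ u₂ j → coeff (walsh k F c u₁ u₂) j ≡
    ∑ elements (λ x → ∑ elements (λ y → χ (u₁ * x + u₂ * y) ℤ.* monoCoeff k (2 ℕ.* (c ℕ.* F x y)) j))
  coeff-walsh c u₁ u₂ j = begin
    coeff (walsh k F c u₁ u₂) j
      ≡⟨ cong (λ W → coeff W j) (proj₂ (walsh-summand c u₁ u₂)) ⟩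
    coeff (sumC (map t pairs)) j
      ≡⟨ coeff-sumC (map t pairs) j ⟩
    ∑ (map t pairs) (λ a → coeff a j)
      ≡⟨ ∑-map t pairs (λ a → coeff a j) ⟩
    ∑ pairs (λ p → coeff (t p) j)
      ≡⟨ ∑-concatMap (λ x → map (x ,_) elements) elements (λ p → coeff (t p) j) ⟩
    ∑ elements (λ x → ∑ (map (x ,_) elements) (λ p → coeff (t p) j))
      ≡⟨ ∑-cong elements (λ x → ∑-map (x ,_) elements (λ p → coeff (t p) j)) ⟩
    ∑ elements (λ x → ∑ elements (λ y → coeff (t (x , y)) j))
      ≡⟨ ∑-cong elements (λ x → ∑-cong elements (λ y → coeff-walsh-summand c u₁ u₂ x y j)) ⟩
    ∑ elements (λ x → ∑ elements (λ y → χ (u₁ * x + u₂ * y) ℤ.* monoCoeff k (2 ℕ.* (c ℕ.* F x y)) j)) ∎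
    where
    t : Carrier × Carrier → Cyc k
    t = proj₁ (walsh-summand c u₁ u₂)

  module WalshCoefficient (c : ℕ) (0<c : 0 < c) (c<K : c < K) (u₁ u₂ : Carrier) (j : Fin K) where

    ζ : Carrier → ℤ
    ζ = ζ^cG c j

    column : Carrier → ℤ
    column y = ∑ elements (λ x → χ (u₁ * x + u₂ * y) ℤ.* monoCoeff k (2 ℕ.* (c ℕ.* F x y)) j)

    -- The column y ≢ 0, reindexed by x = z y.
    column′ : Carrier → ℤ
    column′ y = ∑ elements (λ z → χ (y * (u₁ * z + u₂)) ℤ.* ζ z)

    column-≢0 : ∀ {y} → y ≢ 0# → column y ≡ column′ y
    column-≢0 {y} y≢0 = begin
      column y
        ≡⟨ ∑-reindex unique complete (_* y) (_* y ⁻¹) cancel cancel′ _ ⟨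
      ∑ elements (λ z → χ (u₁ * (z * y) + u₂ * y) ℤ.* monoCoeff k (2 ℕ.* (c ℕ.* F (z * y) y)) j)
        ≡⟨ ∑-cong elements (λ z → cong₂ ℤ._*_ (cong χ (factor z)) (cong (λ n → monoCoeff k (2 ℕ.* (c ℕ.* n)) j) (F-scaled z y≢0))) ⟩
      column′ y ∎
      where
      cancel : ∀ z → z * y * y ⁻¹ ≡ z
      cancel z = trans (*-assoc z y (y ⁻¹)) (trans (cong (z *_) (inverseʳ y y≢0)) (*-identityʳ z))
      cancel′ : ∀ x → x * y ⁻¹ * y ≡ x
      cancel′ x = trans (*-assoc x (y ⁻¹) y) (trans (cong (x *_) (trans (*-comm (y ⁻¹) y) (inverseʳ y y≢0))) (*-identityʳ x))
      factor : ∀ z → u₁ * (z * y) + u₂ * y ≡ y * (u₁ * z + u₂)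
      factor z = sym (trans (distribˡ y (u₁ * z) u₂) (cong₂ _+_ (trans (*-comm y (u₁ * z)) (*-assoc u₁ z y)) (*-comm y u₂)))

    column-0# : column 0# ≡ characterSum u₁ ℤ.* monoCoeff k 0 j
    column-0# = begin
      column 0#
        ≡⟨ ∑-cong elements (λ x → cong₂ ℤ._*_ (cong χ (u₂*0-vanishes x)) (cong (λ n → monoCoeff k n j) (F-vanishes x))) ⟩
      ∑ elements (λ x → χ (u₁ * x) ℤ.* monoCoeff k 0 j)
        ≡⟨ ∑-*ʳ (monoCoeff k 0 j) elements (λ x → χ (u₁ * x)) ⟨
      characterSum u₁ ℤ.* monoCoeff k 0 j ∎
      where
      u₂*0-vanishes : ∀ x → u₁ * x + u₂ * 0# ≡ u₁ * x
      u₂*0-vanishes x = trans (cong (u₁ * x +_) (zeroʳ u₂)) (+-identityʳ _)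
      F-vanishes : ∀ x → 2 ℕ.* (c ℕ.* F x 0#) ≡ 0
      F-vanishes x = cong (2 ℕ.*_) (trans (cong (c ℕ.*_) (F-0# x)) (ℕ.*-zeroʳ c))

    column′-0# : column′ 0# ≡ 0ℤ
    column′-0# = begin
      column′ 0#            ≡⟨ ∑-cong elements (λ z → cong (ℤ._* ζ z) (χ-Tr≡0 (trans (cong Tr (zeroˡ _)) Tr-0))) ⟩
      ∑ elements (λ z → 1ℤ ℤ.* ζ z) ≡⟨ ∑-cong elements (λ z → ℤ.*-identityˡ (ζ z)) ⟩
      ∑ elements ζ          ≡⟨ ∑-ζ^cG c 0<c c<K j ⟩
      0ℤ                    ∎

    at-0# : Carrier → ℤ
    at-0# y = if does (y ≟ 0#) then column 0# else 0ℤ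

    column-split : ∀ y → column y ≡ column′ y ℤ.+ at-0# y
    column-split y = by-cases (y ≟ 0#)
      where
      by-cases : (d : Dec (y ≡ 0#)) → column y ≡ column′ y ℤ.+ (if does d then column 0# else 0ℤ)
      by-cases (yes refl) = sym (trans (cong (ℤ._+ column 0#) column′-0#) (ℤ.+-identityˡ _))
      by-cases (no  y≢0)  = trans (column-≢0 y≢0) (sym (ℤ.+-identityʳ _))

    ∑-at-0# : ∑ elements at-0# ≡ column 0#
    ∑-at-0# = trans (∑-single elements at-0# unique (complete 0#) off) (cong (λ b → if b then column 0# else 0ℤ) (dec-true (0# ≟ 0#) refl))
      where
      off : ∀ {y} → y ∈ elements → y ≢ 0# → at-0# y ≡ 0ℤ
      off {y} _ y≢0 = cong (λ b → if b then column 0# else 0ℤ) (dec-false (y ≟ 0#) y≢0)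

    ∑-column′ : ∑ elements column′ ≡ ∑ elements (λ z → characterSum (u₁ * z + u₂) ℤ.* ζ z)
    ∑-column′ = trans (∑-comm elements elements (λ y z → χ (y * (u₁ * z + u₂)) ℤ.* ζ z)) (∑-cong elements λ z → begin
      ∑ elements (λ y → χ (y * (u₁ * z + u₂)) ℤ.* ζ z)  ≡⟨ ∑-cong elements (λ y → cong (λ t → χ t ℤ.* ζ z) (*-comm y _)) ⟩
      ∑ elements (λ y → χ ((u₁ * z + u₂) * y) ℤ.* ζ z)  ≡⟨ ∑-*ʳ (ζ z) elements (λ y → χ ((u₁ * z + u₂) * y)) ⟨
      characterSum (u₁ * z + u₂) ℤ.* ζ z                ∎)

    walsh-coefficient : coeff (walsh k F c u₁ u₂) j ≡
                        ∑ elements (λ z → characterSum (u₁ * z + u₂) ℤ.* ζ z) ℤ.+ characterSum u₁ ℤ.* monoCoeff k 0 j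
    walsh-coefficient = begin
      coeff (walsh k F c u₁ u₂) j
        ≡⟨ coeff-walsh c u₁ u₂ j ⟩
      ∑ elements (λ x → ∑ elements (λ y → χ (u₁ * x + u₂ * y) ℤ.* monoCoeff k (2 ℕ.* (c ℕ.* F x y)) j))
        ≡⟨ ∑-comm elements elements _ ⟩
      ∑ elements column
        ≡⟨ ∑-cong elements column-split ⟩
      ∑ elements (λ y → column′ y ℤ.+ at-0# y)
        ≡⟨ ∑-distrib elements column′ at-0# ⟩
      ∑ elements column′ ℤ.+ ∑ elements at-0#
        ≡⟨ cong₂ ℤ._+_ ∑-column′ (trans ∑-at-0# column-0#) ⟩
      ∑ elements (λ z → characterSum (u₁ * z + u₂) ℤ.* ζ z) ℤ.+ characterSum u₁ ℤ.* monoCoeff k 0 j ∎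

    walsh-coefficient-u₁≡0 : u₁ ≡ 0# → coeff (walsh k F c u₁ u₂) j ≡ ℤ.+ (2 ^ m) ℤ.* monoCoeff k 0 j
    walsh-coefficient-u₁≡0 u₁≡0 = begin
      coeff (walsh k F c u₁ u₂) j
        ≡⟨ walsh-coefficient ⟩
      ∑ elements (λ z → characterSum (u₁ * z + u₂) ℤ.* ζ z) ℤ.+ characterSum u₁ ℤ.* monoCoeff k 0 j
        ≡⟨ cong₂ ℤ._+_ constant (cong (λ u → characterSum u ℤ.* monoCoeff k 0 j) u₁≡0) ⟩
      ∑ elements (λ z → characterSum u₂ ℤ.* ζ z) ℤ.+ characterSum 0# ℤ.* monoCoeff k 0 j
        ≡⟨ cong₂ ℤ._+_ (∑-*ˡ (characterSum u₂) elements ζ) (cong (ℤ._* monoCoeff k 0 j) (sym characterSum-0#)) ⟨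
      characterSum u₂ ℤ.* ∑ elements ζ ℤ.+ ℤ.+ (2 ^ m) ℤ.* monoCoeff k 0 j
        ≡⟨ cong (λ t → characterSum u₂ ℤ.* t ℤ.+ ℤ.+ (2 ^ m) ℤ.* monoCoeff k 0 j) (∑-ζ^cG c 0<c c<K j) ⟩
      characterSum u₂ ℤ.* 0ℤ ℤ.+ ℤ.+ (2 ^ m) ℤ.* monoCoeff k 0 j
        ≡⟨ cong (ℤ._+ ℤ.+ (2 ^ m) ℤ.* monoCoeff k 0 j) (ℤ.*-zeroʳ (characterSum u₂)) ⟩
      0ℤ ℤ.+ ℤ.+ (2 ^ m) ℤ.* monoCoeff k 0 j
        ≡⟨ ℤ.+-identityˡ _ ⟩
      ℤ.+ (2 ^ m) ℤ.* monoCoeff k 0 j ∎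
      where
      constant : ∑ elements (λ z → characterSum (u₁ * z + u₂) ℤ.* ζ z) ≡ ∑ elements (λ z → characterSum u₂ ℤ.* ζ z)
      constant = ∑-cong elements λ z →
        cong (λ t → characterSum t ℤ.* ζ z) (trans (cong (λ u → u * z + u₂) u₁≡0) (trans (cong (_+ u₂) (zeroˡ z)) (+-identityˡ u₂)))

    walsh-coefficient-u₁≢0 : u₁ ≢ 0# → coeff (walsh k F c u₁ u₂) j ≡ ℤ.+ (2 ^ m) ℤ.* ζ (u₁ ⁻¹ * u₂)
    walsh-coefficient-u₁≢0 u₁≢0 = begin
      coeff (walsh k F c u₁ u₂) j
        ≡⟨ walsh-coefficient ⟩
      ∑ elements (λ z → characterSum (u₁ * z + u₂) ℤ.* ζ z) ℤ.+ characterSum u₁ ℤ.* monoCoeff k 0 j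
        ≡⟨ cong₂ ℤ._+_ (∑-single elements _ unique (complete z₀) off) (cong (ℤ._* monoCoeff k 0 j) (characterSum-≢0 u₁≢0)) ⟩
      characterSum (u₁ * z₀ + u₂) ℤ.* ζ z₀ ℤ.+ 0ℤ ℤ.* monoCoeff k 0 j
        ≡⟨ ℤ.+-identityʳ _ ⟩
      characterSum (u₁ * z₀ + u₂) ℤ.* ζ z₀
        ≡⟨ cong (λ t → characterSum t ℤ.* ζ z₀) (trans (cong (_+ u₂) (x*[x⁻¹*y]≡y u₁≢0 u₂)) (x+x≡0 u₂)) ⟩
      characterSum 0# ℤ.* ζ z₀
        ≡⟨ cong (ℤ._* ζ z₀) characterSum-0# ⟩
      ℤ.+ (2 ^ m) ℤ.* ζ z₀ ∎
      where
      z₀ : Carrier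
      z₀ = u₁ ⁻¹ * u₂
      off : ∀ {z} → z ∈ elements → z ≢ z₀ → characterSum (u₁ * z + u₂) ℤ.* ζ z ≡ 0ℤ
      off {z} _ z≢z₀ = trans (cong (ℤ._* ζ z) (characterSum-≢0 λ u₁z+u₂≡0 →
                         z≢z₀ (trans (sym (x⁻¹*[x*y]≡y u₁≢0 z)) (cong (u₁ ⁻¹ *_) (x+y≡0⇒x≡y u₁z+u₂≡0)))))
                             (ℤ.*-zeroˡ (ζ z))

  walsh-monomial : ∀ c → 0 < c → c < K → ∀ u₁ u₂ → ∃ λ e → IsMonomial (walsh k F c u₁ u₂) (ℤ.+ (2 ^ m)) e
  walsh-monomial c 0<c c<K u₁ u₂ with u₁ ≟ 0#
  ... | yes u₁≡0 = 0 , λ j → WalshCoefficient.walsh-coefficient-u₁≡0 c 0<c c<K u₁ u₂ j u₁≡0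
  ... | no  u₁≢0 = 2 ℕ.* (c ℕ.* G (u₁ ⁻¹ * u₂)) , λ j → WalshCoefficient.walsh-coefficient-u₁≢0 c 0<c c<K u₁ u₂ j u₁≢0

theorem4p10 : (m k : ℕ) (𝔽 : GF2^ m) (α : Fin k → GF2^.Carrier 𝔽) →
    FieldOps.LinIndepF2 𝔽 k α →
    Bent.IsZ2^kBent 𝔽 k (Bent.Fα 𝔽 k α)
theorem4p10 m k 𝔽 α ind u₁ u₂ c 0<c c<2^k =
  CyclotomicMonomials.monomial-AbsEq k {n = 2 ^ m} (proj₂ (WalshSpectrum.walsh-monomial 𝔽 k α ind c 0<c c<2^k u₁ u₂))
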